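{- The $32$-dimensional Barnes–Wall lattice $BW_{32}$ contains a $2k$-frame if and only if $k$ is an integer with $k\ge2$.
   Context: $BW_{32}$ is the $32$-dimensional Barnes–Wall lattice, an even unimodular lattice with minimum norm $4$. A $k$-frame of a unimodular lattice $L$ of dimension $n$ is a set $\{f_1,\dots,f_n\}\subset L$ with $(f_i,f_j)=k\delta_{i,j}$. -}

module Defs where

open import Data.Bool using (Bool; true; false)
open import Data.Nat using (ℕ; suc)
open import Data.Integer using (ℤ; +_; _+_; _*_; _-_)
open import Data.Product using (_×_; _,_; proj₁; proj₂; ∃)
open import Data.List using (List; []; _∷_; _++_; map; foldr)
open import Data.Vec using (Vec; []; _∷_)
open import Data.Fin using (Fin)
open import Relation.Binary.PropositionalEquality using (_≡_; _≢_)

-- Gaussian integers ℤ[i], a + b i represented as (a , b)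
ℤ[i] : Set
ℤ[i] = ℤ × ℤ

_+ᵍ_ : ℤ[i] → ℤ[i] → ℤ[i]
(a , b) +ᵍ (c , d) = (a + c , b + d)

_*ᵍ_ : ℤ[i] → ℤ[i] → ℤ[i]
(a , b) *ᵍ (c , d) = (a * c - b * d , a * d + b * c)

0ᵍ 1ᵍ 1+i : ℤ[i]
0ᵍ = (+ 0 , + 0)
1ᵍ = (+ 1 , + 0)
1+i = (+ 1 , + 1)

-- all binary words of length k (index set of ℤ[i]^(2^k))
words : (k : ℕ) → List (Vec Bool k)
words 0 = [] ∷ []
words (suc k) = map (false ∷_) (words k) ++ map (true ∷_) (words k)

sumᵍ : {k : ℕ} → (Vec Bool k → ℤ[i]) → ℤ[i]
sumᵍ {k} f = foldr (λ w acc → f w +ᵍ acc) 0ᵍ (words k)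

sumℤ : {k : ℕ} → (Vec Bool k → ℤ) → ℤ
sumℤ {k} f = foldr (λ w acc → f w + acc) (+ 0) (words k)

H : Bool → Bool → ℤ[i]
H false false = 1ᵍ
H false true  = 1ᵍ
H true  false = 0ᵍ
H true  true  = 1+i

H⊗ : {k : ℕ} → Vec Bool k → Vec Bool k → ℤ[i]
H⊗ [] [] = 1ᵍ
H⊗ (r ∷ rs) (c ∷ cs) = H r c *ᵍ H⊗ rs cs

-- Vectors of ℤ[i]^16 ≅ ℤ^32 (real coordinates: real and imaginary parts)
V32 : Set
V32 = Vec Bool 4 → ℤ[i]

-- BW₃₂ (Nebe–Rains–Sloane): the ℤ[i]-span of the rows of H^{⊗4},
-- viewed as a real lattice in ℝ^32 with inner product (x,y) = (1/4) Σ Re(x_j conj(y_j)).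
-- (With this scaling it is even unimodular with minimum 4.)
InBW32 : V32 → Set
InBW32 v = ∃ λ (c : Vec Bool 4 → ℤ[i]) →
  ∀ col → v col ≡ sumᵍ (λ row → c row *ᵍ H⊗ row col)

-- 4 × the inner product of BW₃₂:  Σ_j Re(x_j conj(y_j))
inner4 : V32 → V32 → ℤ
inner4 x y = sumℤ (λ j → proj₁ (x j) * proj₁ (y j) + proj₂ (x j) * proj₂ (y j))

-- an m-frame of BW₃₂: 32 lattice vectors f₁..f₃₂ with (f_i , f_j) = m δ_ij,
-- i.e. inner4 (f i) (f j) = 4 m δ_ij
IsFrame : ℕ → (Fin 32 → V32) → Set
IsFrame m f = (∀ i → InBW32 (f i))
  × (∀ i j → i ≡ j → inner4 (f i) (f j) ≡ + (4 Data.Nat.* m))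
  × (∀ i j → i ≢ j → inner4 (f i) (f j) ≡ + 0)

module Submission where

-- BW₃₂ is the last lattice Λ₄ of the tower Λ₀ = ℤ[i], Λₖ₊₁ = {(u | u + (1+i) v) : u, v ∈ Λₖ}.
-- Inductively, the hermitian form Σ xⱼ conj(yⱼ) on Λₖ takes values in (1+i)ᵏ ℤ[i]; for k = 4 this and
-- the symmetry of the form make every norm (f, f) even, and the same recursion shows that nonzero
-- vectors of Λₖ have Σ |xⱼ|² ≥ 2ᵏ, i.e. (f, f) ≥ 4. So the norm m of a frame is even and at least 4.
-- Conversely, 16 explicit blocks of five vectors of Λ₃, doubled to (u | ±u), give for every x ∈ ℤ⁵ a
-- frame of norm 4 (x₁² + x₂² + x₃² + x₄²) + 6 x₅², and by Lagrange's four-square theorem these norms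
-- are exactly the 2k with k ≥ 2.

module BarnesWallLattice where

  open import Defs
  open import Data.Bool using (Bool; true; false)
  open import Data.Nat as ℕ using (ℕ; zero; suc; _^_; z≤n; s≤s)
  import Data.Nat.Properties as ℕ
  open import Data.Nat.Tactic.RingSolver using () renaming (solve-∀ to solve-∀ℕ)
  open import Data.Nat.Induction using (<-rec)
  open import Data.Nat.Divisibility using (_∣_; divides; ∣⇒≤)
  open import Data.Nat.Divisibility.Core using (hasNonTrivialDivisor)
  open import Data.Nat.Primality using (Prime; prime; euclidsLemma; prime⇒nonZero; prime⇒nonTrivial)
  open import Data.Nat.Primality.Factorisation using (factorise; PrimeFactorisation)
  open import Data.Nat.ListAction using (product)
  open import Data.Integer using (ℤ; +_; -[1+_]; _+_; _*_; _-_; -_; _≤_; _<_; +≤+; +<+; _%ℕ_; _/ℕ_; ∣_∣)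
  import Data.Integer.Properties as ℤ
  import Data.Integer.DivMod as ℤ/
  open import Data.Integer.Tactic.RingSolver using (solve-∀)
  open import Data.Product using (_×_; _,_; proj₁; proj₂; ∃; ∃₂)
  import Data.Product.Properties as Product
  open import Data.Sum using (_⊎_; inj₁; inj₂)
  open import Data.List using (List; []; _∷_; _++_; map; foldr)
  open import Data.List.Relation.Unary.All using (All; []; _∷_)
  open import Data.Vec using (Vec; []; _∷_; lookup)
  import Data.Vec.Properties as Vec
  open import Data.Fin as Fin using (Fin; zero; suc; #_; toℕ; fromℕ<; splitAt; join)
  import Data.Fin.Properties as Fin
  open import Data.Fin.Properties using (all?)
  open import Data.Empty using (⊥; ⊥-elim)
  open import Data.Unit using (tt)
  open import Function using (_∘_)
  open import Relation.Nullary using (¬_; Dec; does)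
  open import Relation.Nullary.Decidable using (toWitness; map′; _×-dec_; dec-true; dec-false)
  open import Relation.Binary.Definitions using (tri<; tri≈; tri>)
  open import Relation.Binary.PropositionalEquality

  re im : ℤ[i] → ℤ
  re = proj₁
  im = proj₂

  conj : ℤ[i] → ℤ[i]
  conj (a , b) = (a , - b)

  -- z ·̄ w = z · conj w
  _·̄_ : ℤ[i] → ℤ[i] → ℤ[i]
  (a , b) ·̄ (c , d) = (a * c + b * d , b * c - a * d)

  absSq : ℤ[i] → ℤ
  absSq (a , b) = a * a + b * b

  1-i 2ᵍ : ℤ[i]
  1-i = (+ 1 , -[1+ 0 ])
  2ᵍ = (+ 2 , + 0)

  +ᵍ-identityˡ : ∀ a → 0ᵍ +ᵍ a ≡ a
  +ᵍ-identityˡ (a , b) = cong₂ _,_ (ℤ.+-identityˡ a) (ℤ.+-identityˡ b)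

  +ᵍ-identityʳ : ∀ a → a +ᵍ 0ᵍ ≡ a
  +ᵍ-identityʳ (a , b) = cong₂ _,_ (ℤ.+-identityʳ a) (ℤ.+-identityʳ b)

  +ᵍ-assoc : ∀ a b c → (a +ᵍ b) +ᵍ c ≡ a +ᵍ (b +ᵍ c)
  +ᵍ-assoc (a , b) (c , d) (e , f) = cong₂ _,_ (ℤ.+-assoc a c e) (ℤ.+-assoc b d f)

  +ᵍ-interchange : ∀ a b c d → (a +ᵍ b) +ᵍ (c +ᵍ d) ≡ (a +ᵍ c) +ᵍ (b +ᵍ d)
  +ᵍ-interchange (a , a') (b , b') (c , c') (d , d') = cong₂ _,_ (law a b c d) (law a' b' c' d')
    where
    law : ∀ a b c d → (a + b) + (c + d) ≡ (a + c) + (b + d)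
    law = solve-∀

  *ᵍ-comm : ∀ a b → a *ᵍ b ≡ b *ᵍ a
  *ᵍ-comm (a , b) (c , d) = cong₂ _,_ (re-law a b c d) (im-law a b c d)
    where
    re-law : ∀ a b c d → a * c - b * d ≡ c * a - d * b
    re-law = solve-∀
    im-law : ∀ a b c d → a * d + b * c ≡ c * b + d * a
    im-law = solve-∀

  *ᵍ-assoc : ∀ a b c → (a *ᵍ b) *ᵍ c ≡ a *ᵍ (b *ᵍ c)
  *ᵍ-assoc (a , b) (c , d) (e , f) = cong₂ _,_ (re-law a b c d e f) (im-law a b c d e f)
    where
    re-law : ∀ a b c d e f → (a * c - b * d) * e - (a * d + b * c) * f ≡ a * (c * e - d * f) - b * (c * f + d * e)
    re-law = solve-∀
    im-law : ∀ a b c d e f → (a * c - b * d) * f + (a * d + b * c) * e ≡ a * (c * f + d * e) + b * (c * e - d * f)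
    im-law = solve-∀

  *ᵍ-distribˡ-+ᵍ : ∀ a b c → a *ᵍ (b +ᵍ c) ≡ (a *ᵍ b) +ᵍ (a *ᵍ c)
  *ᵍ-distribˡ-+ᵍ (a , b) (c , d) (e , f) = cong₂ _,_ (re-law a b c d e f) (im-law a b c d e f)
    where
    re-law : ∀ a b c d e f → a * (c + e) - b * (d + f) ≡ (a * c - b * d) + (a * e - b * f)
    re-law = solve-∀
    im-law : ∀ a b c d e f → a * (d + f) + b * (c + e) ≡ (a * d + b * c) + (a * f + b * e)
    im-law = solve-∀

  *ᵍ-identityˡ : ∀ a → 1ᵍ *ᵍ a ≡ a
  *ᵍ-identityˡ (a , b) = cong₂ _,_ (re-law a b) (im-law a b)
    where
    re-law : ∀ a b → + 1 * a - + 0 * b ≡ a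
    re-law = solve-∀
    im-law : ∀ a b → + 1 * b + + 0 * a ≡ b
    im-law = solve-∀

  *ᵍ-zeroˡ : ∀ a → 0ᵍ *ᵍ a ≡ 0ᵍ
  *ᵍ-zeroˡ (a , b) = cong₂ _,_ (re-law a b) (im-law a b)
    where
    re-law : ∀ a b → + 0 * a - + 0 * b ≡ + 0
    re-law = solve-∀
    im-law : ∀ a b → + 0 * b + + 0 * a ≡ + 0
    im-law = solve-∀

  *ᵍ-zeroʳ : ∀ a → a *ᵍ 0ᵍ ≡ 0ᵍ
  *ᵍ-zeroʳ a = trans (*ᵍ-comm a 0ᵍ) (*ᵍ-zeroˡ a)

  ∑ᵍ : {A : Set} → List A → (A → ℤ[i]) → ℤ[i]
  ∑ᵍ xs f = foldr (λ w acc → f w +ᵍ acc) 0ᵍ xs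

  ∑ᵍ-++ : {A : Set} (xs ys : List A) (f : A → ℤ[i]) → ∑ᵍ (xs ++ ys) f ≡ ∑ᵍ xs f +ᵍ ∑ᵍ ys f
  ∑ᵍ-++ []       ys f = sym (+ᵍ-identityˡ _)
  ∑ᵍ-++ (x ∷ xs) ys f = trans (cong (f x +ᵍ_) (∑ᵍ-++ xs ys f)) (sym (+ᵍ-assoc (f x) _ _))

  ∑ᵍ-map : {A B : Set} (g : A → B) (xs : List A) (f : B → ℤ[i]) → ∑ᵍ (map g xs) f ≡ ∑ᵍ xs (f ∘ g)
  ∑ᵍ-map g []       f = refl
  ∑ᵍ-map g (x ∷ xs) f = cong (f (g x) +ᵍ_) (∑ᵍ-map g xs f)

  ∑ᵍ-cong : {A : Set} (xs : List A) {f g : A → ℤ[i]} → (∀ w → f w ≡ g w) → ∑ᵍ xs f ≡ ∑ᵍ xs g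
  ∑ᵍ-cong []       e = refl
  ∑ᵍ-cong (x ∷ xs) e = cong₂ _+ᵍ_ (e x) (∑ᵍ-cong xs e)

  ∑ᵍ-+ : {A : Set} (xs : List A) (f g : A → ℤ[i]) → ∑ᵍ xs (λ w → f w +ᵍ g w) ≡ ∑ᵍ xs f +ᵍ ∑ᵍ xs g
  ∑ᵍ-+ []       f g = sym (+ᵍ-identityˡ 0ᵍ)
  ∑ᵍ-+ (x ∷ xs) f g =
    trans (cong ((f x +ᵍ g x) +ᵍ_) (∑ᵍ-+ xs f g)) (+ᵍ-interchange (f x) (g x) (∑ᵍ xs f) (∑ᵍ xs g))

  ∑ᵍ-* : {A : Set} (xs : List A) (c : ℤ[i]) (f : A → ℤ[i]) → ∑ᵍ xs (λ w → c *ᵍ f w) ≡ c *ᵍ ∑ᵍ xs f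
  ∑ᵍ-* []       c f = sym (*ᵍ-zeroʳ c)
  ∑ᵍ-* (x ∷ xs) c f = trans (cong ((c *ᵍ f x) +ᵍ_) (∑ᵍ-* xs c f)) (sym (*ᵍ-distribˡ-+ᵍ c (f x) _))

  ∑ᵍ-0 : {A : Set} (xs : List A) → ∑ᵍ xs (λ _ → 0ᵍ) ≡ 0ᵍ
  ∑ᵍ-0 []       = refl
  ∑ᵍ-0 (_ ∷ xs) = trans (cong (0ᵍ +ᵍ_) (∑ᵍ-0 xs)) (+ᵍ-identityˡ 0ᵍ)

  sumᵍ-suc : ∀ k (f : Vec Bool (suc k) → ℤ[i]) →
    sumᵍ f ≡ sumᵍ (f ∘ (false ∷_)) +ᵍ sumᵍ (f ∘ (true ∷_))
  sumᵍ-suc k f = begin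
    ∑ᵍ (map (false ∷_) (words k) ++ map (true ∷_) (words k)) f
      ≡⟨ ∑ᵍ-++ (map (false ∷_) (words k)) _ f ⟩
    ∑ᵍ (map (false ∷_) (words k)) f +ᵍ ∑ᵍ (map (true ∷_) (words k)) f
      ≡⟨ cong₂ _+ᵍ_ (∑ᵍ-map (false ∷_) (words k) f) (∑ᵍ-map (true ∷_) (words k) f) ⟩
    sumᵍ (f ∘ (false ∷_)) +ᵍ sumᵍ (f ∘ (true ∷_)) ∎
    where open ≡-Reasoning

  re-∑ᵍ : {A : Set} (xs : List A) (f : A → ℤ[i]) → re (∑ᵍ xs f) ≡ foldr (λ w acc → re (f w) + acc) (+ 0) xs
  re-∑ᵍ []       f = refl
  re-∑ᵍ (x ∷ xs) f = cong (_+_ (re (f x))) (re-∑ᵍ xs f)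

  -- The lattice tower

  V : ℕ → Set
  V k = Vec Bool k → ℤ[i]

  combRows : ∀ k → V k → V k
  combRows k c col = sumᵍ (λ row → c row *ᵍ H⊗ row col)

  InBW : ∀ k → V k → Set
  InBW k v = ∃ λ c → v ≗ combRows k c

  -- The (u | u + (1+i) v) construction, which builds the row span of H^{⊗(k+1)} from that of H^{⊗k}.
  plotkin : ∀ {k} → V k → V k → V (suc k)
  plotkin x y (false ∷ w) = x w
  plotkin x y (true  ∷ w) = x w +ᵍ (1+i *ᵍ y w)

  InBW-resp : ∀ k {u v : V k} → InBW k u → u ≗ v → InBW k v
  InBW-resp k (c , u≗) u≗v = c , λ w → trans (sym (u≗v w)) (u≗ w)

  combRows-lin : ∀ k (c d : V k) α β →
    combRows k (λ r → (α *ᵍ c r) +ᵍ (β *ᵍ d r)) ≗ λ w → (α *ᵍ combRows k c w) +ᵍ (β *ᵍ combRows k d w)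
  combRows-lin k c d α β w = begin
    sumᵍ (λ r → ((α *ᵍ c r) +ᵍ (β *ᵍ d r)) *ᵍ H⊗ r w)
      ≡⟨ ∑ᵍ-cong (words k) (λ r → distrib (c r) (d r) (H⊗ r w)) ⟩
    sumᵍ (λ r → (α *ᵍ (c r *ᵍ H⊗ r w)) +ᵍ (β *ᵍ (d r *ᵍ H⊗ r w)))
      ≡⟨ ∑ᵍ-+ (words k) (λ r → α *ᵍ (c r *ᵍ H⊗ r w)) (λ r → β *ᵍ (d r *ᵍ H⊗ r w)) ⟩
    sumᵍ (λ r → α *ᵍ (c r *ᵍ H⊗ r w)) +ᵍ sumᵍ (λ r → β *ᵍ (d r *ᵍ H⊗ r w))
      ≡⟨ cong₂ _+ᵍ_ (∑ᵍ-* (words k) α (λ r → c r *ᵍ H⊗ r w)) (∑ᵍ-* (words k) β (λ r → d r *ᵍ H⊗ r w)) ⟩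
    (α *ᵍ combRows k c w) +ᵍ (β *ᵍ combRows k d w) ∎
    where
    open ≡-Reasoning
    distrib : ∀ a b h → ((α *ᵍ a) +ᵍ (β *ᵍ b)) *ᵍ h ≡ (α *ᵍ (a *ᵍ h)) +ᵍ (β *ᵍ (b *ᵍ h))
    distrib a b h = begin
      ((α *ᵍ a) +ᵍ (β *ᵍ b)) *ᵍ h         ≡⟨ *ᵍ-comm ((α *ᵍ a) +ᵍ (β *ᵍ b)) h ⟩
      h *ᵍ ((α *ᵍ a) +ᵍ (β *ᵍ b))         ≡⟨ *ᵍ-distribˡ-+ᵍ h (α *ᵍ a) (β *ᵍ b) ⟩
      (h *ᵍ (α *ᵍ a)) +ᵍ (h *ᵍ (β *ᵍ b))   ≡⟨ cong₂ _+ᵍ_ (*ᵍ-comm h (α *ᵍ a)) (*ᵍ-comm h (β *ᵍ b)) ⟩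
      ((α *ᵍ a) *ᵍ h) +ᵍ ((β *ᵍ b) *ᵍ h)   ≡⟨ cong₂ _+ᵍ_ (*ᵍ-assoc α a h) (*ᵍ-assoc β b h) ⟩
      (α *ᵍ (a *ᵍ h)) +ᵍ (β *ᵍ (b *ᵍ h))   ∎

  InBW-lin : ∀ k {x y : V k} α β → InBW k x → InBW k y → InBW k (λ w → (α *ᵍ x w) +ᵍ (β *ᵍ y w))
  InBW-lin k α β (c , x≗) (d , y≗) = (λ r → (α *ᵍ c r) +ᵍ (β *ᵍ d r)) ,
    λ w → trans (cong₂ (λ s t → (α *ᵍ s) +ᵍ (β *ᵍ t)) (x≗ w) (y≗ w)) (sym (combRows-lin k c d α β w))

  InBW-scale : ∀ k {x : V k} α → InBW k x → InBW k (λ w → α *ᵍ x w)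
  InBW-scale k {x} α Lx = InBW-resp k (InBW-lin k α 0ᵍ Lx Lx)
    (λ w → trans (cong ((α *ᵍ x w) +ᵍ_) (*ᵍ-zeroˡ (x w))) (+ᵍ-identityʳ (α *ᵍ x w)))

  InBW-0 : ∀ k → InBW k (λ _ → 0ᵍ)
  InBW-0 k = (λ _ → 0ᵍ) , λ w → sym (trans (∑ᵍ-cong (words k) (λ r → *ᵍ-zeroˡ (H⊗ r w))) (∑ᵍ-0 (words k)))

  combRows-suc : ∀ k (c : V (suc k)) →
    combRows (suc k) c ≗ plotkin (combRows k (c ∘ (false ∷_))) (combRows k (c ∘ (true ∷_)))
  combRows-suc k c (b ∷ w) = begin
    sumᵍ (λ row → c row *ᵍ H⊗ row (b ∷ w))
      ≡⟨ sumᵍ-suc k (λ row → c row *ᵍ H⊗ row (b ∷ w)) ⟩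
    sumᵍ (λ r → c (false ∷ r) *ᵍ (H false b *ᵍ H⊗ r w)) +ᵍ sumᵍ (λ r → c (true ∷ r) *ᵍ (H true b *ᵍ H⊗ r w))
      ≡⟨ cong₂ _+ᵍ_ (pull-out false) (pull-out true) ⟩
    (H false b *ᵍ X) +ᵍ (H true b *ᵍ Y)
      ≡⟨ rows b ⟩
    plotkin X' Y' (b ∷ w) ∎
    where
    open ≡-Reasoning
    X' Y' : V k
    X' = combRows k (c ∘ (false ∷_))
    Y' = combRows k (c ∘ (true ∷_))
    X Y : ℤ[i]
    X = X' w
    Y = Y' w
    pull-out : ∀ a → sumᵍ (λ r → c (a ∷ r) *ᵍ (H a b *ᵍ H⊗ r w)) ≡ H a b *ᵍ combRows k (c ∘ (a ∷_)) w
    pull-out a = trans (∑ᵍ-cong (words k) swap) (∑ᵍ-* (words k) (H a b) (λ r → c (a ∷ r) *ᵍ H⊗ r w))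
      where
      swap : ∀ r → c (a ∷ r) *ᵍ (H a b *ᵍ H⊗ r w) ≡ H a b *ᵍ (c (a ∷ r) *ᵍ H⊗ r w)
      swap r = begin
        c (a ∷ r) *ᵍ (H a b *ᵍ H⊗ r w)  ≡⟨ *ᵍ-assoc (c (a ∷ r)) (H a b) (H⊗ r w) ⟨
        (c (a ∷ r) *ᵍ H a b) *ᵍ H⊗ r w  ≡⟨ cong (_*ᵍ H⊗ r w) (*ᵍ-comm (c (a ∷ r)) (H a b)) ⟩
        (H a b *ᵍ c (a ∷ r)) *ᵍ H⊗ r w  ≡⟨ *ᵍ-assoc (H a b) (c (a ∷ r)) (H⊗ r w) ⟩
        H a b *ᵍ (c (a ∷ r) *ᵍ H⊗ r w)  ∎
    rows : ∀ b → (H false b *ᵍ X) +ᵍ (H true b *ᵍ Y) ≡ plotkin X' Y' (b ∷ w)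
    rows false = trans (cong₂ _+ᵍ_ (*ᵍ-identityˡ X) (*ᵍ-zeroˡ Y)) (+ᵍ-identityʳ X)
    rows true  = cong (_+ᵍ (1+i *ᵍ Y)) (*ᵍ-identityˡ X)

  InBW-plotkin : ∀ k {x y : V k} → InBW k x → InBW k y → InBW (suc k) (plotkin x y)
  InBW-plotkin k {x} {y} (c , x≗) (d , y≗) = cd , λ w → trans (plotkin-cong w) (sym (combRows-suc k cd w))
    where
    cd : V (suc k)
    cd (false ∷ r) = c r
    cd (true  ∷ r) = d r
    plotkin-cong : plotkin x y ≗ plotkin (combRows k c) (combRows k d)
    plotkin-cong (false ∷ w) = x≗ w
    plotkin-cong (true  ∷ w) = cong₂ (λ s t → s +ᵍ (1+i *ᵍ t)) (x≗ w) (y≗ w)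

  InBW-unplotkin : ∀ k {v : V (suc k)} → InBW (suc k) v →
    ∃₂ λ x y → InBW k x × InBW k y × v ≗ plotkin x y
  InBW-unplotkin k (c , v≗) =
    combRows k (c ∘ (false ∷_)) , combRows k (c ∘ (true ∷_)) ,
    (c ∘ (false ∷_) , λ _ → refl) , (c ∘ (true ∷_) , λ _ → refl) ,
    λ w → trans (v≗ w) (combRows-suc k c w)

  -- The hermitian form

  herm : ∀ k → V k → V k → ℤ[i]
  herm k x y = sumᵍ (λ j → x j ·̄ y j)

  inner : ∀ k → V k → V k → ℤ
  inner k x y = re (herm k x y)

  norm : ∀ k → V k → ℤ
  norm k v = inner k v v

  inner4≡inner : ∀ x y → inner4 x y ≡ inner 4 x y
  inner4≡inner x y = sym (re-∑ᵍ (words 4) (λ j → x j ·̄ y j))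

  herm-cong : ∀ k {x x' y y' : V k} → x ≗ x' → y ≗ y' → herm k x y ≡ herm k x' y'
  herm-cong k x≗ y≗ = ∑ᵍ-cong (words k) (λ j → cong₂ _·̄_ (x≗ j) (y≗ j))

  herm-suc : ∀ k (x y : V (suc k)) →
    herm (suc k) x y ≡ herm k (x ∘ (false ∷_)) (y ∘ (false ∷_)) +ᵍ herm k (x ∘ (true ∷_)) (y ∘ (true ∷_))
  herm-suc k x y = sumᵍ-suc k (λ j → x j ·̄ y j)

  herm-swap : ∀ k (x y : V k) → herm k y x ≡ conj (herm k x y)
  herm-swap k x y = trans (∑ᵍ-cong (words k) (λ j → ·̄-swap (x j) (y j))) (conj-∑ᵍ (words k))
    where
    ·̄-swap : ∀ a b → b ·̄ a ≡ conj (a ·̄ b)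
    ·̄-swap (a1 , a2) (b1 , b2) = cong₂ _,_ (re-law a1 a2 b1 b2) (im-law a1 a2 b1 b2)
      where
      re-law : ∀ a1 a2 b1 b2 → b1 * a1 + b2 * a2 ≡ a1 * b1 + a2 * b2
      re-law = solve-∀
      im-law : ∀ a1 a2 b1 b2 → b2 * a1 - b1 * a2 ≡ - (a2 * b1 - a1 * b2)
      im-law = solve-∀
    conj-∑ᵍ : (xs : List (Vec Bool k)) → ∑ᵍ xs (λ j → conj (x j ·̄ y j)) ≡ conj (∑ᵍ xs (λ j → x j ·̄ y j))
    conj-∑ᵍ []       = refl
    conj-∑ᵍ (j ∷ xs) = trans (cong ((conj (x j ·̄ y j)) +ᵍ_) (conj-∑ᵍ xs))
      (cong (re (∑ᵍ (j ∷ xs) (λ i → x i ·̄ y i)) ,_) (sym (ℤ.neg-distrib-+ (im (x j ·̄ y j)) (im (∑ᵍ xs (λ i → x i ·̄ y i))))))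

  herm-self-real : ∀ k (x : V k) → im (herm k x x) ≡ + 0
  herm-self-real k x = self-conjugate (cong im (herm-swap k x x))
    where
    self-conjugate : ∀ {b} → b ≡ - b → b ≡ + 0
    self-conjugate {+ zero}    _  = refl
    self-conjugate {+ suc _}   ()
    self-conjugate { -[1+ _ ]} ()

  herm-scale : ∀ k c (x : V k) → herm k (λ j → c *ᵍ x j) (λ j → c *ᵍ x j) ≡ (absSq c , + 0) *ᵍ herm k x x
  herm-scale k c x = trans (∑ᵍ-cong (words k) (λ j → ·̄-scale c (x j))) (∑ᵍ-* (words k) (absSq c , + 0) (λ j → x j ·̄ x j))
    where
    ·̄-scale : ∀ c a → (c *ᵍ a) ·̄ (c *ᵍ a) ≡ (absSq c , + 0) *ᵍ (a ·̄ a)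
    ·̄-scale (c1 , c2) (a1 , a2) = cong₂ _,_ (re-law c1 c2 a1 a2) (im-law c1 c2 a1 a2)
      where
      re-law : ∀ c1 c2 a1 a2 →
        (c1 * a1 - c2 * a2) * (c1 * a1 - c2 * a2) + (c1 * a2 + c2 * a1) * (c1 * a2 + c2 * a1)
        ≡ (c1 * c1 + c2 * c2) * (a1 * a1 + a2 * a2) - (+ 0) * (a2 * a1 - a1 * a2)
      re-law = solve-∀
      im-law : ∀ c1 c2 a1 a2 →
        (c1 * a2 + c2 * a1) * (c1 * a1 - c2 * a2) - (c1 * a1 - c2 * a2) * (c1 * a2 + c2 * a1)
        ≡ (c1 * c1 + c2 * c2) * (a2 * a1 - a1 * a2) + (+ 0) * (a1 * a1 + a2 * a2)
      im-law = solve-∀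

  herm-plotkin : ∀ k (x y x' y' : V k) → herm (suc k) (plotkin x y) (plotkin x' y') ≡
    ((2ᵍ *ᵍ herm k x x') +ᵍ (1-i *ᵍ herm k x y')) +ᵍ ((1+i *ᵍ herm k y x') +ᵍ (2ᵍ *ᵍ herm k y y'))
  herm-plotkin k x y x' y' = begin
    herm (suc k) (plotkin x y) (plotkin x' y')
      ≡⟨ herm-suc k (plotkin x y) (plotkin x' y') ⟩
    h x x' +ᵍ sumᵍ (λ j → (x j +ᵍ (1+i *ᵍ y j)) ·̄ (x' j +ᵍ (1+i *ᵍ y' j)))
      ≡⟨ cong (h x x' +ᵍ_) (∑ᵍ-cong (words k) (λ j → expand (x j) (y j) (x' j) (y' j))) ⟩
    h x x' +ᵍ sumᵍ (λ j → AB j +ᵍ CD j)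
      ≡⟨ cong (h x x' +ᵍ_) (trans (∑ᵍ-+ (words k) AB CD) (cong₂ _+ᵍ_ (∑ᵍ-+ (words k) hxx hxy′) (∑ᵍ-+ (words k) hyx′ hyy′))) ⟩
    h x x' +ᵍ ((h x x' +ᵍ sumᵍ hxy′) +ᵍ (sumᵍ hyx′ +ᵍ sumᵍ hyy′))
      ≡⟨ cong (λ t → h x x' +ᵍ ((h x x' +ᵍ t) +ᵍ (sumᵍ hyx′ +ᵍ sumᵍ hyy′))) (∑ᵍ-* (words k) 1-i hxy) ⟩
    h x x' +ᵍ ((h x x' +ᵍ (1-i *ᵍ h x y')) +ᵍ (sumᵍ hyx′ +ᵍ sumᵍ hyy′))
      ≡⟨ cong (λ t → h x x' +ᵍ ((h x x' +ᵍ (1-i *ᵍ h x y')) +ᵍ t)) (cong₂ _+ᵍ_ (∑ᵍ-* (words k) 1+i hyx) (∑ᵍ-* (words k) 2ᵍ hyy)) ⟩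
    h x x' +ᵍ ((h x x' +ᵍ (1-i *ᵍ h x y')) +ᵍ ((1+i *ᵍ h y x') +ᵍ (2ᵍ *ᵍ h y y')))
      ≡⟨ collect (h x x') (1-i *ᵍ h x y') ((1+i *ᵍ h y x') +ᵍ (2ᵍ *ᵍ h y y')) ⟩
    ((2ᵍ *ᵍ h x x') +ᵍ (1-i *ᵍ h x y')) +ᵍ ((1+i *ᵍ h y x') +ᵍ (2ᵍ *ᵍ h y y')) ∎
    where
    open ≡-Reasoning
    h = herm k
    hxx hxy hyx hyy : Vec Bool k → ℤ[i]
    hxx j = x j ·̄ x' j
    hxy j = x j ·̄ y' j
    hyx j = y j ·̄ x' j
    hyy j = y j ·̄ y' j
    hxy′ hyx′ hyy′ AB CD : Vec Bool k → ℤ[i]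
    hxy′ j = 1-i *ᵍ hxy j
    hyx′ j = 1+i *ᵍ hyx j
    hyy′ j = 2ᵍ *ᵍ hyy j
    AB j = hxx j +ᵍ hxy′ j
    CD j = hyx′ j +ᵍ hyy′ j
    collect : ∀ a b c → a +ᵍ ((a +ᵍ b) +ᵍ c) ≡ ((2ᵍ *ᵍ a) +ᵍ b) +ᵍ c
    collect (a1 , a2) (b1 , b2) (c1 , c2) = cong₂ _,_ (law a1 a2 b1 c1) (law a2 a1 b2 c2)
      where
      law : ∀ a a' b c → a + ((a + b) + c) ≡ ((+ 2) * a - (+ 0) * a' + b) + c
      law = solve-∀
    expand : ∀ a b a' b' → (a +ᵍ (1+i *ᵍ b)) ·̄ (a' +ᵍ (1+i *ᵍ b')) ≡
      ((a ·̄ a') +ᵍ (1-i *ᵍ (a ·̄ b'))) +ᵍ ((1+i *ᵍ (b ·̄ a')) +ᵍ (2ᵍ *ᵍ (b ·̄ b')))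
    expand (x1 , x2) (y1 , y2) (u1 , u2) (v1 , v2) =
      cong₂ _,_ (re-law x1 x2 y1 y2 u1 u2 v1 v2) (im-law x1 x2 y1 y2 u1 u2 v1 v2)
      where
      re-law : ∀ x1 x2 y1 y2 u1 u2 v1 v2 →
        (x1 + ((+ 1) * y1 - (+ 1) * y2)) * (u1 + ((+ 1) * v1 - (+ 1) * v2)) + (x2 + ((+ 1) * y2 + (+ 1) * y1)) * (u2 + ((+ 1) * v2 + (+ 1) * v1))
        ≡ ((x1 * u1 + x2 * u2) + ((+ 1) * (x1 * v1 + x2 * v2) - (-[1+ 0 ]) * (x2 * v1 - x1 * v2))) + (((+ 1) * (y1 * u1 + y2 * u2) - (+ 1) * (y2 * u1 - y1 * u2)) + ((+ 2) * (y1 * v1 + y2 * v2) - (+ 0) * (y2 * v1 - y1 * v2)))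
      re-law = solve-∀
      im-law : ∀ x1 x2 y1 y2 u1 u2 v1 v2 →
        (x2 + ((+ 1) * y2 + (+ 1) * y1)) * (u1 + ((+ 1) * v1 - (+ 1) * v2)) - (x1 + ((+ 1) * y1 - (+ 1) * y2)) * (u2 + ((+ 1) * v2 + (+ 1) * v1))
        ≡ ((x2 * u1 - x1 * u2) + ((+ 1) * (x2 * v1 - x1 * v2) + (-[1+ 0 ]) * (x1 * v1 + x2 * v2))) + (((+ 1) * (y2 * u1 - y1 * u2) + (+ 1) * (y1 * u1 + y2 * u2)) + ((+ 2) * (y2 * v1 - y1 * v2) + (+ 0) * (y1 * v1 + y2 * v2)))
      im-law = solve-∀

  -- Evenness and minimum

  record _∣ᵍ_ (d z : ℤ[i]) : Set where
    constructor divides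
    field
      quotient : ℤ[i]
      equation : z ≡ d *ᵍ quotient

  ∣ᵍ-+ : ∀ {d a b} → d ∣ᵍ a → d ∣ᵍ b → d ∣ᵍ (a +ᵍ b)
  ∣ᵍ-+ {d} (divides q refl) (divides q' refl) = divides (q +ᵍ q') (sym (*ᵍ-distribˡ-+ᵍ d q q'))

  infix 30 [1+i]^_
  [1+i]^_ : ℕ → ℤ[i]
  [1+i]^ zero  = 1ᵍ
  [1+i]^ suc n = 1+i *ᵍ [1+i]^ n

  -- Applied with c = 1-i, -i, 1: 2 = (1+i)(1-i), 1-i = (1+i)(-i) and 1+i are all multiples of 1+i.
  [1+i]^-step : ∀ n c {z} → [1+i]^ n ∣ᵍ z → [1+i]^ suc n ∣ᵍ ((1+i *ᵍ c) *ᵍ z)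
  [1+i]^-step n c (divides q refl) = divides (c *ᵍ q) (begin
    (1+i *ᵍ c) *ᵍ (P *ᵍ q)   ≡⟨ *ᵍ-assoc 1+i c (P *ᵍ q) ⟩
    1+i *ᵍ (c *ᵍ (P *ᵍ q))   ≡⟨ cong (1+i *ᵍ_) (*ᵍ-assoc c P q) ⟨
    1+i *ᵍ ((c *ᵍ P) *ᵍ q)   ≡⟨ cong (λ t → 1+i *ᵍ (t *ᵍ q)) (*ᵍ-comm c P) ⟩
    1+i *ᵍ ((P *ᵍ c) *ᵍ q)   ≡⟨ cong (1+i *ᵍ_) (*ᵍ-assoc P c q) ⟩
    1+i *ᵍ (P *ᵍ (c *ᵍ q))   ≡⟨ *ᵍ-assoc 1+i P (c *ᵍ q) ⟨
    [1+i]^ suc n *ᵍ (c *ᵍ q) ∎)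
    where
    open ≡-Reasoning
    P = [1+i]^ n

  herm-divisible : ∀ k {x y : V k} → InBW k x → InBW k y → [1+i]^ k ∣ᵍ herm k x y
  herm-divisible zero    {x} {y} _ _ = divides (herm 0 x y) (sym (*ᵍ-identityˡ (herm 0 x y)))
  herm-divisible (suc k) Lv Lv' with InBW-unplotkin k Lv | InBW-unplotkin k Lv'
  ... | x , y , Lx , Ly , v≗ | x' , y' , Lx' , Ly' , v'≗ =
    subst ([1+i]^ suc k ∣ᵍ_) (sym (trans (herm-cong (suc k) v≗ v'≗) (herm-plotkin k x y x' y')))
      (∣ᵍ-+ (∣ᵍ-+ (step 1-i (herm-divisible k Lx Lx')) (step (+ 0 , -[1+ 0 ]) (herm-divisible k Lx Ly')))
            (∣ᵍ-+ (step 1ᵍ (herm-divisible k Ly Lx')) (step 1-i (herm-divisible k Ly Ly'))))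
    where
    step = [1+i]^-step k

  [1+i]^3-real : ∀ a b → im ([1+i]^ 3 *ᵍ (a , b)) ≡ + 0 → b ≡ a
  [1+i]^3-real a b e = ℤ.*-cancelˡ-≡ (+ 2) b a (trans (shift a b) (trans (cong (_-_ ((+ 2) * a)) e) (ℤ.+-identityʳ _)))
    where
    shift : ∀ a b → (+ 2) * b ≡ (+ 2) * a - ((-[1+ 1 ]) * b + (+ 2) * a)
    shift = solve-∀

  -- [1+i]^ 3 = -2 + 2i; Re(h(x,x)) and Re((1-i) h(x,y)) = Re((1+i) conj h(x,y)) are multiples of 4.
  eight-divides : ∀ a b d → [1+i]^ 3 ∣ᵍ a → im a ≡ + 0 → [1+i]^ 3 ∣ᵍ b → [1+i]^ 3 ∣ᵍ d → im d ≡ + 0 →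
    ∃ λ t → re (((2ᵍ *ᵍ a) +ᵍ (1-i *ᵍ b)) +ᵍ ((1+i *ᵍ conj b) +ᵍ (2ᵍ *ᵍ d))) ≡ + 8 * t
  eight-divides _ _ _ (divides (g , g') refl) ima (divides (q1 , q2) refl) (divides (s , s') refl) imd
    with refl ← [1+i]^3-real g g' ima | refl ← [1+i]^3-real s s' imd = - g - q2 - s , law g q1 q2 s
    where
    law : ∀ g q1 q2 s →
      (((+ 2) * ((-[1+ 1 ]) * g - (+ 2) * g) - (+ 0) * ((-[1+ 1 ]) * g + (+ 2) * g)) + ((+ 1) * ((-[1+ 1 ]) * q1 - (+ 2) * q2) - (-[1+ 0 ]) * ((-[1+ 1 ]) * q2 + (+ 2) * q1))) + (((+ 1) * ((-[1+ 1 ]) * q1 - (+ 2) * q2) - (+ 1) * (- ((-[1+ 1 ]) * q2 + (+ 2) * q1))) + ((+ 2) * ((-[1+ 1 ]) * s - (+ 2) * s) - (+ 0) * ((-[1+ 1 ]) * s + (+ 2) * s)))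
      ≡ + 8 * (- g - q2 - s)
    law = solve-∀

  norm4-even : ∀ {v} → InBW 4 v → ∃ λ t → norm 4 v ≡ + 8 * t
  norm4-even {v} Lv with InBW-unplotkin 3 Lv
  ... | x , y , Lx , Ly , v≗ =
    subst (λ z → ∃ λ t → re z ≡ + 8 * t) (sym shape)
      (eight-divides (herm 3 x x) (herm 3 x y) (herm 3 y y)
        (herm-divisible 3 Lx Lx) (herm-self-real 3 x) (herm-divisible 3 Lx Ly) (herm-divisible 3 Ly Ly) (herm-self-real 3 y))
    where
    shape : herm 4 v v ≡ ((2ᵍ *ᵍ herm 3 x x) +ᵍ (1-i *ᵍ herm 3 x y)) +ᵍ ((1+i *ᵍ conj (herm 3 x y)) +ᵍ (2ᵍ *ᵍ herm 3 y y))
    shape = begin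
      herm 4 v v                             ≡⟨ herm-cong 4 v≗ v≗ ⟩
      herm 4 (plotkin x y) (plotkin x y)     ≡⟨ herm-plotkin 3 x y x y ⟩
      ((2ᵍ *ᵍ herm 3 x x) +ᵍ (1-i *ᵍ herm 3 x y)) +ᵍ ((1+i *ᵍ herm 3 y x) +ᵍ (2ᵍ *ᵍ herm 3 y y))
        ≡⟨ cong (λ h → ((2ᵍ *ᵍ herm 3 x x) +ᵍ (1-i *ᵍ herm 3 x y)) +ᵍ ((1+i *ᵍ h) +ᵍ (2ᵍ *ᵍ herm 3 y y))) (herm-swap 3 x y) ⟩
      ((2ᵍ *ᵍ herm 3 x x) +ᵍ (1-i *ᵍ herm 3 x y)) +ᵍ ((1+i *ᵍ conj (herm 3 x y)) +ᵍ (2ᵍ *ᵍ herm 3 y y)) ∎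
      where open ≡-Reasoning

  norm-cong : ∀ k {u v : V k} → u ≗ v → norm k u ≡ norm k v
  norm-cong k u≗v = cong re (herm-cong k u≗v u≗v)

  norm-suc : ∀ k (v : V (suc k)) → norm (suc k) v ≡ norm k (v ∘ (false ∷_)) + norm k (v ∘ (true ∷_))
  norm-suc k v = cong re (herm-suc k v v)

  norm-scale : ∀ k c (v : V k) → norm k (λ j → c *ᵍ v j) ≡ absSq c * norm k v
  norm-scale k c v = trans (cong re (herm-scale k c v)) (law (absSq c) (norm k v) (im (herm k v v)))
    where
    law : ∀ n r i → n * r - (+ 0) * i ≡ n * r
    law = solve-∀

  square-nonneg : ∀ a → + 0 ≤ a * a
  square-nonneg (+ zero)  = +≤+ z≤n
  square-nonneg (+ suc _) = +≤+ z≤n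
  square-nonneg -[1+ _ ]  = +≤+ z≤n

  square≡0 : ∀ a → a * a ≡ + 0 → a ≡ + 0
  square≡0 (+ zero) _ = refl

  nonneg-sum≡0 : ∀ {a b} → + 0 ≤ a → + 0 ≤ b → a + b ≡ + 0 → a ≡ + 0 × b ≡ + 0
  nonneg-sum≡0 {+ zero} {+ zero} _ _ _ = refl , refl

  norm-nonneg : ∀ k (v : V k) → + 0 ≤ norm k v
  norm-nonneg zero    v = ℤ.+-mono-≤ (ℤ.+-mono-≤ (square-nonneg (re (v []))) (square-nonneg (im (v [])))) ℤ.≤-refl
  norm-nonneg (suc k) v = subst (+ 0 ≤_) (sym (norm-suc k v))
    (ℤ.+-mono-≤ (norm-nonneg k (v ∘ (false ∷_))) (norm-nonneg k (v ∘ (true ∷_))))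

  norm-halves≡0 : ∀ k (v : V (suc k)) → norm (suc k) v ≡ + 0 →
    norm k (v ∘ (false ∷_)) ≡ + 0 × norm k (v ∘ (true ∷_)) ≡ + 0
  norm-halves≡0 k v n≡0 = nonneg-sum≡0 (norm-nonneg k (v ∘ (false ∷_))) (norm-nonneg k (v ∘ (true ∷_)))
    (trans (sym (norm-suc k v)) n≡0)

  norm≡0⇒≗0 : ∀ k (v : V k) → norm k v ≡ + 0 → v ≗ λ _ → 0ᵍ
  norm≡0⇒≗0 zero v n≡0 []
    with re≡0 , im≡0 ← nonneg-sum≡0 (square-nonneg (re (v []))) (square-nonneg (im (v [])))
                         (trans (sym (ℤ.+-identityʳ _)) n≡0)
    = cong₂ _,_ (square≡0 (re (v [])) re≡0) (square≡0 (im (v [])) im≡0)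
  norm≡0⇒≗0 (suc k) v n≡0 (false ∷ w) = norm≡0⇒≗0 k (v ∘ (false ∷_)) (proj₁ (norm-halves≡0 k v n≡0)) w
  norm≡0⇒≗0 (suc k) v n≡0 (true  ∷ w) = norm≡0⇒≗0 k (v ∘ (true ∷_)) (proj₂ (norm-halves≡0 k v n≡0)) w

  +ᵍ-[1+i]-cancel : ∀ a b → a +ᵍ (1+i *ᵍ b) ≡ 0ᵍ → a ≡ (-[1+ 0 ] , -[1+ 0 ]) *ᵍ b
  +ᵍ-[1+i]-cancel (a1 , a2) (b1 , b2) e =
    cong₂ _,_ (trans (re-law a1 b1 b2) (trans (cong (_+ re t) (cong re e)) (ℤ.+-identityˡ (re t))))
              (trans (im-law a2 b1 b2) (trans (cong (_+ im t) (cong im e)) (ℤ.+-identityˡ (im t))))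
    where
    t = (-[1+ 0 ] , -[1+ 0 ]) *ᵍ (b1 , b2)
    re-law : ∀ a b1 b2 → a ≡ (a + ((+ 1) * b1 - (+ 1) * b2)) + ((-[1+ 0 ]) * b1 - (-[1+ 0 ]) * b2)
    re-law = solve-∀
    im-law : ∀ a b1 b2 → a ≡ (a + ((+ 1) * b2 + (+ 1) * b1)) + ((-[1+ 0 ]) * b2 + (-[1+ 0 ]) * b1)
    im-law = solve-∀

  Gap : ℕ → ℤ → Set
  Gap k n = n ≡ + 0 ⊎ + (2 ^ k) ≤ n

  2^suc : ∀ k → + (2 ^ suc k) ≡ + (2 ^ k) + + (2 ^ k)
  2^suc k = trans (cong +_ (cong (2 ^ k ℕ.+_) (ℕ.+-identityʳ (2 ^ k)))) (ℤ.pos-+ (2 ^ k) (2 ^ k))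

  Gap-nonneg : ∀ {n} → + 0 ≤ n → Gap 0 n
  Gap-nonneg {+ zero}  _ = inj₁ refl
  Gap-nonneg {+ suc _} _ = inj₂ (+≤+ (s≤s z≤n))

  Gap-double : ∀ k {n} → Gap k n → Gap (suc k) (+ 2 * n)
  Gap-double k (inj₁ refl) = inj₁ refl
  Gap-double k {n} (inj₂ 2^k≤n) = inj₂ (begin
    + (2 ^ suc k)         ≡⟨ 2^suc k ⟩
    + (2 ^ k) + + (2 ^ k) ≤⟨ ℤ.+-mono-≤ 2^k≤n 2^k≤n ⟩
    n + n                 ≡⟨ law n ⟩
    + 2 * n               ∎)
    where
    open ℤ.≤-Reasoning
    law : ∀ n → n + n ≡ + 2 * n
    law = solve-∀

  -- For k = 4: BW₃₂ has minimum 16 / 4 = 4.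
  norm-gap : ∀ k {v : V k} → InBW k v → Gap k (norm k v)
  norm-gap zero    {v} _ = Gap-nonneg (norm-nonneg zero v)
  norm-gap (suc k) {v} Lv with InBW-unplotkin k Lv
  ... | x , y , Lx , Ly , v≗ = subst (Gap (suc k)) (sym split) (combine (norm-gap k Lx) (norm-gap k Lz))
    where
    z : V k
    z w = x w +ᵍ (1+i *ᵍ y w)
    Lz : InBW k z
    Lz = InBW-resp k (InBW-lin k 1ᵍ 1+i Lx Ly) (λ w → cong (_+ᵍ (1+i *ᵍ y w)) (*ᵍ-identityˡ (x w)))
    split : norm (suc k) v ≡ norm k x + norm k z
    split = trans (norm-cong (suc k) v≗) (norm-suc k (plotkin x y))
    x≡0⇒ : norm k x ≡ + 0 → norm k z ≡ + 2 * norm k y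
    x≡0⇒ x0 = trans (norm-cong k (λ w → trans (cong (_+ᵍ (1+i *ᵍ y w)) (norm≡0⇒≗0 k x x0 w)) (+ᵍ-identityˡ (1+i *ᵍ y w))))
                    (norm-scale k 1+i y)
    z≡0⇒ : norm k z ≡ + 0 → norm k x ≡ + 2 * norm k y
    z≡0⇒ z0 = trans (norm-cong k (λ w → +ᵍ-[1+i]-cancel (x w) (y w) (norm≡0⇒≗0 k z z0 w)))
                    (norm-scale k (-[1+ 0 ] , -[1+ 0 ]) y)
    combine : Gap k (norm k x) → Gap k (norm k z) → Gap (suc k) (norm k x + norm k z)
    combine (inj₁ x0) _ = subst (Gap (suc k)) (sym (trans (cong₂ _+_ x0 (x≡0⇒ x0)) (ℤ.+-identityˡ (+ 2 * norm k y))))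
      (Gap-double k (norm-gap k Ly))
    combine (inj₂ _) (inj₁ z0) = subst (Gap (suc k)) (sym (trans (cong₂ _+_ (z≡0⇒ z0) z0) (ℤ.+-identityʳ (+ 2 * norm k y))))
      (Gap-double k (norm-gap k Ly))
    combine (inj₂ px) (inj₂ pz) = inj₂ (ℤ.≤-trans (ℤ.≤-reflexive (2^suc k)) (ℤ.+-mono-≤ px pz))

  norm-of-frame-vector : ∀ m {n : ℤ} → 1 ℕ.≤ m → n ≡ + (4 ℕ.* m) → (∃ λ t → n ≡ + 8 * t) → Gap 4 n →
    ∃ λ k → 2 ℕ.≤ k × m ≡ 2 ℕ.* k
  norm-of-frame-vector zero    ()
  norm-of-frame-vector (suc m) _ n≡4m _ (inj₁ n≡0) with () ← trans (sym n≡4m) n≡0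
  norm-of-frame-vector m _ n≡4m (-[1+ _ ] , n≡8t) _ with () ← trans (sym n≡4m) n≡8t
  norm-of-frame-vector m {n} _ n≡4m (+ t , n≡8t) (inj₂ 16≤n) = t , 2≤t , m≡2t
    where
    4m≡8t : 4 ℕ.* m ≡ 8 ℕ.* t
    4m≡8t = ℤ.+-injective (trans (sym n≡4m) (trans n≡8t (sym (ℤ.pos-* 8 t))))
    m≡2t : m ≡ 2 ℕ.* t
    m≡2t = ℕ.*-cancelˡ-≡ m (2 ℕ.* t) 4 (trans 4m≡8t (ℕ.*-assoc 4 2 t))
    2≤t : 2 ℕ.≤ t
    2≤t = ℕ.*-cancelˡ-≤ 8 (ℕ.≤-trans (ℤ.drop‿+≤+ (ℤ.≤-trans 16≤n (ℤ.≤-reflexive n≡4m))) (ℕ.≤-reflexive 4m≡8t))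

  frame⇒even : ∀ m → 1 ℕ.≤ m → (∃ λ (f : Fin 32 → V32) → IsFrame m f) → ∃ λ k → 2 ℕ.≤ k × m ≡ 2 ℕ.* k
  frame⇒even m 1≤m (f , f∈BW , f-diag , _) =
    norm-of-frame-vector m 1≤m (trans (sym (inner4≡inner v v)) (f-diag Fin.zero Fin.zero refl))
      (norm4-even (f∈BW Fin.zero)) (norm-gap 4 (f∈BW Fin.zero))
    where
    v = f Fin.zero

  -- Integer combinations and the frame

  _·ᵍ_ : ℤ → ℤ[i] → ℤ[i]
  s ·ᵍ (a , b) = (s * a , s * b)

  ·ᵍ-as-*ᵍ : ∀ s z → (s , + 0) *ᵍ z ≡ s ·ᵍ z
  ·ᵍ-as-*ᵍ s (a , b) = cong₂ _,_ (re-law s a b) (im-law s a b)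
    where
    re-law : ∀ s a b → s * a - + 0 * b ≡ s * a
    re-law = solve-∀
    im-law : ∀ s a b → s * b + + 0 * a ≡ s * b
    im-law = solve-∀

  ∑ᵍ-· : {A : Set} (xs : List A) (s : ℤ) (f : A → ℤ[i]) → ∑ᵍ xs (λ w → s ·ᵍ f w) ≡ s ·ᵍ ∑ᵍ xs f
  ∑ᵍ-· []       s f = cong₂ _,_ (sym (ℤ.*-zeroʳ s)) (sym (ℤ.*-zeroʳ s))
  ∑ᵍ-· (x ∷ xs) s f = trans (cong ((s ·ᵍ f x) +ᵍ_) (∑ᵍ-· xs s f))
    (cong₂ _,_ (sym (ℤ.*-distribˡ-+ s (re (f x)) _)) (sym (ℤ.*-distribˡ-+ s (im (f x)) _)))

  combo : ∀ {k n} → Vec ℤ n → (Fin n → V k) → V k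
  combo []       u w = 0ᵍ
  combo (a ∷ as) u w = (a ·ᵍ u zero w) +ᵍ combo as (u ∘ suc) w

  InBW-combo : ∀ k {n} (a : Vec ℤ n) {u : Fin n → V k} → (∀ i → InBW k (u i)) → InBW k (combo a u)
  InBW-combo k []       _  = InBW-0 k
  InBW-combo k (a ∷ as) {u} Lu = InBW-resp k (InBW-lin k (a , + 0) 1ᵍ (Lu zero) (InBW-combo k as (Lu ∘ suc)))
    (λ w → cong₂ _+ᵍ_ (·ᵍ-as-*ᵍ a (u zero w)) (*ᵍ-identityˡ (combo as (u ∘ suc) w)))

  lin : ∀ {n} → Vec ℤ n → (Fin n → ℤ) → ℤ
  lin []       g = + 0
  lin (a ∷ as) g = a * g zero + lin as (g ∘ suc)

  lin-cong : ∀ {n} (a : Vec ℤ n) {g h : Fin n → ℤ} → (∀ i → g i ≡ h i) → lin a g ≡ lin a h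
  lin-cong []       _   = refl
  lin-cong (a ∷ as) g≡h = cong₂ (λ s t → a * s + t) (g≡h zero) (lin-cong as (g≡h ∘ suc))

  herm-zeroˡ : ∀ k (y : V k) → herm k (λ _ → 0ᵍ) y ≡ 0ᵍ
  herm-zeroˡ k y = trans (∑ᵍ-cong (words k) (λ j → 0ᵍ-·̄ (y j))) (∑ᵍ-0 (words k))
    where
    0ᵍ-·̄ : ∀ c → 0ᵍ ·̄ c ≡ 0ᵍ
    0ᵍ-·̄ (c1 , c2) = cong₂ _,_ (re-law c1 c2) (im-law c1 c2)
      where
      re-law : ∀ c1 c2 → + 0 * c1 + + 0 * c2 ≡ + 0
      re-law = solve-∀
      im-law : ∀ c1 c2 → + 0 * c1 - + 0 * c2 ≡ + 0
      im-law = solve-∀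

  herm-zeroʳ : ∀ k (x : V k) → herm k x (λ _ → 0ᵍ) ≡ 0ᵍ
  herm-zeroʳ k x = trans (herm-swap k (λ _ → 0ᵍ) x) (cong conj (herm-zeroˡ k x))

  herm-linˡ : ∀ k s (u v y : V k) → herm k (λ w → (s ·ᵍ u w) +ᵍ v w) y ≡ (s ·ᵍ herm k u y) +ᵍ herm k v y
  herm-linˡ k s u v y = begin
    sumᵍ (λ j → ((s ·ᵍ u j) +ᵍ v j) ·̄ y j)             ≡⟨ ∑ᵍ-cong (words k) (λ j → distrib (u j) (v j) (y j)) ⟩
    sumᵍ (λ j → (s ·ᵍ (u j ·̄ y j)) +ᵍ (v j ·̄ y j))      ≡⟨ ∑ᵍ-+ (words k) (λ j → s ·ᵍ (u j ·̄ y j)) (λ j → v j ·̄ y j) ⟩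
    sumᵍ (λ j → s ·ᵍ (u j ·̄ y j)) +ᵍ herm k v y         ≡⟨ cong (_+ᵍ herm k v y) (∑ᵍ-· (words k) s (λ j → u j ·̄ y j)) ⟩
    (s ·ᵍ herm k u y) +ᵍ herm k v y                       ∎
    where
    open ≡-Reasoning
    distrib : ∀ a b c → ((s ·ᵍ a) +ᵍ b) ·̄ c ≡ (s ·ᵍ (a ·̄ c)) +ᵍ (b ·̄ c)
    distrib (a1 , a2) (b1 , b2) (c1 , c2) = cong₂ _,_ (re-law s a1 a2 b1 b2 c1 c2) (im-law s a1 a2 b1 b2 c1 c2)
      where
      re-law : ∀ s a1 a2 b1 b2 c1 c2 → (s * a1 + b1) * c1 + (s * a2 + b2) * c2 ≡ s * (a1 * c1 + a2 * c2) + (b1 * c1 + b2 * c2)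
      re-law = solve-∀
      im-law : ∀ s a1 a2 b1 b2 c1 c2 → (s * a2 + b2) * c1 - (s * a1 + b1) * c2 ≡ s * (a2 * c1 - a1 * c2) + (b2 * c1 - b1 * c2)
      im-law = solve-∀

  herm-linʳ : ∀ k s (x u v : V k) → herm k x (λ w → (s ·ᵍ u w) +ᵍ v w) ≡ (s ·ᵍ herm k x u) +ᵍ herm k x v
  herm-linʳ k s x u v = begin
    herm k x (λ w → (s ·ᵍ u w) +ᵍ v w)                ≡⟨ herm-swap k (λ w → (s ·ᵍ u w) +ᵍ v w) x ⟩
    conj (herm k (λ w → (s ·ᵍ u w) +ᵍ v w) x)         ≡⟨ cong conj (herm-linˡ k s u v x) ⟩
    conj ((s ·ᵍ herm k u x) +ᵍ herm k v x)            ≡⟨ conj-lin (herm k u x) (herm k v x) ⟩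
    (s ·ᵍ conj (herm k u x)) +ᵍ conj (herm k v x)     ≡⟨ cong₂ (λ a b → (s ·ᵍ a) +ᵍ b) (herm-swap k u x) (herm-swap k v x) ⟨
    (s ·ᵍ herm k x u) +ᵍ herm k x v                   ∎
    where
    open ≡-Reasoning
    conj-lin : ∀ a b → conj ((s ·ᵍ a) +ᵍ b) ≡ (s ·ᵍ conj a) +ᵍ conj b
    conj-lin (a1 , a2) (b1 , b2) = cong (s * a1 + b1 ,_) (law s a2 b2)
      where
      law : ∀ s a b → - (s * a + b) ≡ s * (- a) + - b
      law = solve-∀

  inner-comboˡ : ∀ k {n} (a : Vec ℤ n) (u : Fin n → V k) y → inner k (combo a u) y ≡ lin a (λ i → inner k (u i) y)
  inner-comboˡ k []       u y = cong re (herm-zeroˡ k y)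
  inner-comboˡ k (a ∷ as) u y =
    trans (cong re (herm-linˡ k a (u zero) (combo as (u ∘ suc)) y)) (cong (_+_ (a * inner k (u zero) y)) (inner-comboˡ k as (u ∘ suc) y))

  inner-comboʳ : ∀ k {n} x (b : Vec ℤ n) (v : Fin n → V k) → inner k x (combo b v) ≡ lin b (λ j → inner k x (v j))
  inner-comboʳ k x []       v = cong re (herm-zeroʳ k x)
  inner-comboʳ k x (b ∷ bs) v =
    trans (cong re (herm-linʳ k b x (v zero) (combo bs (v ∘ suc)))) (cong (_+_ (b * inner k x (v zero))) (inner-comboʳ k x bs (v ∘ suc)))

  inner-combo : ∀ k {n m} (a : Vec ℤ n) (u : Fin n → V k) (b : Vec ℤ m) (v : Fin m → V k) →
    inner k (combo a u) (combo b v) ≡ lin a (λ i → lin b (λ j → inner k (u i) (v j)))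
  inner-combo k a u b v = trans (inner-comboˡ k a u (combo b v)) (lin-cong a (λ i → inner-comboʳ k (u i) b v))

  ∀-words? : ∀ {k} {P : Vec Bool k → Set} → (∀ w → Dec (P w)) → Dec (∀ w → P w)
  ∀-words? {zero}  P? = map′ (λ p → λ { [] → p }) (λ f → f []) (P? [])
  ∀-words? {suc k} P? = map′ (λ (p , q) → λ { (false ∷ w) → p w ; (true ∷ w) → q w })
    (λ f → f ∘ (false ∷_) , f ∘ (true ∷_)) (∀-words? (P? ∘ (false ∷_)) ×-dec ∀-words? (P? ∘ (true ∷_)))

  _≟ᵍ_ : (a b : ℤ[i]) → Dec (a ≡ b)
  _≟ᵍ_ = Product.≡-dec ℤ._≟_ ℤ._≟_

  -- Entry r, k of Btab is a vector of ℤ[i]^8, listed in the order of wordIndex; entry r, k of Ctab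
  -- holds its coordinates with respect to the rows of H^{⊗3}.
  Btab : Vec (Vec (Vec ℤ[i] 8) 5) 16
  Btab =
    ( ((-[1+ 1 ] , + 2) ∷ (+ 0 , + 0) ∷ (+ 0 , + 0) ∷ (+ 0 , + 0) ∷ (+ 0 , + 0) ∷ (+ 0 , + 0) ∷ (+ 0 , + 0) ∷ (+ 0 , + 0) ∷ [])
      ∷ ((+ 0 , + 0) ∷ (+ 0 , + 0) ∷ (+ 2 , -[1+ 1 ]) ∷ (+ 0 , + 0) ∷ (+ 0 , + 0) ∷ (+ 0 , + 0) ∷ (+ 0 , + 0) ∷ (+ 0 , + 0) ∷ [])
      ∷ ((+ 0 , + 0) ∷ (+ 0 , + 0) ∷ (+ 0 , + 0) ∷ (+ 0 , + 0) ∷ (+ 0 , + 0) ∷ (+ 2 , + 2) ∷ (+ 0 , + 0) ∷ (+ 0 , + 0) ∷ [])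
      ∷ ((+ 0 , + 0) ∷ (+ 0 , + 0) ∷ (+ 0 , + 0) ∷ (+ 0 , + 0) ∷ (+ 0 , + 0) ∷ (+ 0 , + 0) ∷ (+ 0 , + 0) ∷ (+ 2 , + 2) ∷ [])
      ∷ ((-[1+ 0 ] , -[1+ 0 ]) ∷ (+ 0 , -[1+ 1 ]) ∷ (-[1+ 0 ] , -[1+ 0 ]) ∷ (+ 0 , + 0) ∷ (-[1+ 0 ] , -[1+ 0 ]) ∷ (+ 0 , + 0) ∷ (+ 1 , -[1+ 0 ]) ∷ (+ 0 , + 0) ∷ [])
      ∷ [])
    ∷ ( ((-[1+ 1 ] , -[1+ 1 ]) ∷ (+ 0 , + 0) ∷ (+ 0 , + 0) ∷ (+ 0 , + 0) ∷ (+ 0 , + 0) ∷ (+ 0 , + 0) ∷ (+ 0 , + 0) ∷ (+ 0 , + 0) ∷ [])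
      ∷ ((+ 0 , + 0) ∷ (+ 0 , + 0) ∷ (+ 0 , + 0) ∷ (+ 0 , + 0) ∷ (+ 2 , + 2) ∷ (+ 0 , + 0) ∷ (+ 0 , + 0) ∷ (+ 0 , + 0) ∷ [])
      ∷ ((+ 0 , + 0) ∷ (+ 0 , + 0) ∷ (+ 0 , + 0) ∷ (+ 2 , -[1+ 1 ]) ∷ (+ 0 , + 0) ∷ (+ 0 , + 0) ∷ (+ 0 , + 0) ∷ (+ 0 , + 0) ∷ [])
      ∷ ((+ 0 , + 0) ∷ (+ 0 , + 0) ∷ (+ 0 , + 0) ∷ (+ 0 , + 0) ∷ (+ 0 , + 0) ∷ (+ 2 , -[1+ 1 ]) ∷ (+ 0 , + 0) ∷ (+ 0 , + 0) ∷ [])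
      ∷ ((+ 1 , -[1+ 0 ]) ∷ (+ 2 , + 0) ∷ (+ 1 , -[1+ 0 ]) ∷ (+ 0 , + 0) ∷ (+ 1 , -[1+ 0 ]) ∷ (+ 0 , + 0) ∷ (+ 1 , + 1) ∷ (+ 0 , + 0) ∷ [])
      ∷ [])
    ∷ ( ((+ 0 , + 0) ∷ (-[1+ 1 ] , + 2) ∷ (+ 0 , + 0) ∷ (+ 0 , + 0) ∷ (+ 0 , + 0) ∷ (+ 0 , + 0) ∷ (+ 0 , + 0) ∷ (+ 0 , + 0) ∷ [])
      ∷ ((+ 0 , + 0) ∷ (+ 0 , + 0) ∷ (+ 2 , + 2) ∷ (+ 0 , + 0) ∷ (+ 0 , + 0) ∷ (+ 0 , + 0) ∷ (+ 0 , + 0) ∷ (+ 0 , + 0) ∷ [])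
      ∷ ((+ 0 , + 0) ∷ (+ 0 , + 0) ∷ (+ 0 , + 0) ∷ (+ 0 , + 0) ∷ (+ 0 , + 0) ∷ (+ 2 , -[1+ 1 ]) ∷ (+ 0 , + 0) ∷ (+ 0 , + 0) ∷ [])
      ∷ ((+ 0 , + 0) ∷ (+ 0 , + 0) ∷ (+ 0 , + 0) ∷ (-[1+ 1 ] , + 2) ∷ (+ 0 , + 0) ∷ (+ 0 , + 0) ∷ (+ 0 , + 0) ∷ (+ 0 , + 0) ∷ [])
      ∷ ((-[1+ 1 ] , + 0) ∷ (+ 0 , + 0) ∷ (+ 1 , -[1+ 0 ]) ∷ (-[1+ 0 ] , -[1+ 0 ]) ∷ (+ 0 , + 0) ∷ (+ 0 , + 0) ∷ (-[1+ 0 ] , + 1) ∷ (+ 1 , -[1+ 0 ]) ∷ [])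
      ∷ [])
    ∷ ( ((+ 0 , + 0) ∷ (-[1+ 1 ] , -[1+ 1 ]) ∷ (+ 0 , + 0) ∷ (+ 0 , + 0) ∷ (+ 0 , + 0) ∷ (+ 0 , + 0) ∷ (+ 0 , + 0) ∷ (+ 0 , + 0) ∷ [])
      ∷ ((+ 0 , + 0) ∷ (+ 0 , + 0) ∷ (+ 0 , + 0) ∷ (+ 2 , + 2) ∷ (+ 0 , + 0) ∷ (+ 0 , + 0) ∷ (+ 0 , + 0) ∷ (+ 0 , + 0) ∷ [])
      ∷ ((+ 0 , + 0) ∷ (+ 0 , + 0) ∷ (+ 0 , + 0) ∷ (+ 0 , + 0) ∷ (-[1+ 1 ] , + 2) ∷ (+ 0 , + 0) ∷ (+ 0 , + 0) ∷ (+ 0 , + 0) ∷ [])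
      ∷ ((+ 0 , + 0) ∷ (+ 0 , + 0) ∷ (+ 0 , + 0) ∷ (+ 0 , + 0) ∷ (+ 0 , + 0) ∷ (+ 0 , + 0) ∷ (-[1+ 1 ] , + 2) ∷ (+ 0 , + 0) ∷ [])
      ∷ ((+ 0 , -[1+ 1 ]) ∷ (+ 0 , + 0) ∷ (+ 1 , + 1) ∷ (+ 1 , -[1+ 0 ]) ∷ (+ 0 , + 0) ∷ (+ 0 , + 0) ∷ (-[1+ 0 ] , -[1+ 0 ]) ∷ (+ 1 , + 1) ∷ [])
      ∷ [])
    ∷ ( ((+ 0 , + 0) ∷ (+ 0 , + 0) ∷ (-[1+ 1 ] , + 2) ∷ (+ 0 , + 0) ∷ (+ 0 , + 0) ∷ (+ 0 , + 0) ∷ (+ 0 , + 0) ∷ (+ 0 , + 0) ∷ [])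
      ∷ ((-[1+ 1 ] , + 2) ∷ (+ 0 , + 0) ∷ (+ 0 , + 0) ∷ (+ 0 , + 0) ∷ (+ 0 , + 0) ∷ (+ 0 , + 0) ∷ (+ 0 , + 0) ∷ (+ 0 , + 0) ∷ [])
      ∷ ((+ 0 , + 0) ∷ (+ 0 , + 0) ∷ (+ 0 , + 0) ∷ (+ 0 , + 0) ∷ (+ 0 , + 0) ∷ (+ 0 , + 0) ∷ (+ 0 , + 0) ∷ (+ 2 , + 2) ∷ [])
      ∷ ((+ 0 , + 0) ∷ (+ 0 , + 0) ∷ (+ 0 , + 0) ∷ (+ 0 , + 0) ∷ (+ 0 , + 0) ∷ (-[1+ 1 ] , -[1+ 1 ]) ∷ (+ 0 , + 0) ∷ (+ 0 , + 0) ∷ [])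
      ∷ ((-[1+ 0 ] , -[1+ 0 ]) ∷ (-[1+ 0 ] , + 1) ∷ (-[1+ 0 ] , -[1+ 0 ]) ∷ (+ 1 , + 1) ∷ (+ 2 , + 0) ∷ (+ 0 , + 0) ∷ (+ 0 , + 0) ∷ (+ 0 , + 0) ∷ [])
      ∷ [])
    ∷ ( ((+ 0 , + 0) ∷ (+ 0 , + 0) ∷ (-[1+ 1 ] , -[1+ 1 ]) ∷ (+ 0 , + 0) ∷ (+ 0 , + 0) ∷ (+ 0 , + 0) ∷ (+ 0 , + 0) ∷ (+ 0 , + 0) ∷ [])
      ∷ ((+ 0 , + 0) ∷ (-[1+ 1 ] , + 2) ∷ (+ 0 , + 0) ∷ (+ 0 , + 0) ∷ (+ 0 , + 0) ∷ (+ 0 , + 0) ∷ (+ 0 , + 0) ∷ (+ 0 , + 0) ∷ [])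
      ∷ ((+ 0 , + 0) ∷ (+ 0 , + 0) ∷ (+ 0 , + 0) ∷ (+ 0 , + 0) ∷ (+ 0 , + 0) ∷ (+ 0 , + 0) ∷ (+ 2 , + 2) ∷ (+ 0 , + 0) ∷ [])
      ∷ ((+ 0 , + 0) ∷ (+ 0 , + 0) ∷ (+ 0 , + 0) ∷ (+ 0 , + 0) ∷ (+ 0 , + 0) ∷ (+ 0 , + 0) ∷ (+ 0 , + 0) ∷ (-[1+ 1 ] , + 2) ∷ [])
      ∷ ((+ 1 , -[1+ 0 ]) ∷ (-[1+ 0 ] , -[1+ 0 ]) ∷ (+ 1 , -[1+ 0 ]) ∷ (-[1+ 0 ] , + 1) ∷ (+ 0 , + 2) ∷ (+ 0 , + 0) ∷ (+ 0 , + 0) ∷ (+ 0 , + 0) ∷ [])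
      ∷ [])
    ∷ ( ((+ 0 , + 0) ∷ (+ 0 , + 0) ∷ (+ 0 , + 0) ∷ (-[1+ 1 ] , + 2) ∷ (+ 0 , + 0) ∷ (+ 0 , + 0) ∷ (+ 0 , + 0) ∷ (+ 0 , + 0) ∷ [])
      ∷ ((+ 0 , + 0) ∷ (+ 0 , + 0) ∷ (+ 0 , + 0) ∷ (+ 0 , + 0) ∷ (+ 0 , + 0) ∷ (+ 0 , + 0) ∷ (+ 0 , + 0) ∷ (-[1+ 1 ] , + 2) ∷ [])
      ∷ ((-[1+ 1 ] , -[1+ 1 ]) ∷ (+ 0 , + 0) ∷ (+ 0 , + 0) ∷ (+ 0 , + 0) ∷ (+ 0 , + 0) ∷ (+ 0 , + 0) ∷ (+ 0 , + 0) ∷ (+ 0 , + 0) ∷ [])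
      ∷ ((+ 0 , + 0) ∷ (+ 2 , -[1+ 1 ]) ∷ (+ 0 , + 0) ∷ (+ 0 , + 0) ∷ (+ 0 , + 0) ∷ (+ 0 , + 0) ∷ (+ 0 , + 0) ∷ (+ 0 , + 0) ∷ [])
      ∷ ((+ 0 , + 0) ∷ (-[1+ 0 ] , -[1+ 0 ]) ∷ (+ 1 , + 1) ∷ (+ 0 , + 0) ∷ (+ 1 , -[1+ 0 ]) ∷ (-[1+ 1 ] , + 0) ∷ (+ 0 , + 0) ∷ (-[1+ 0 ] , -[1+ 0 ]) ∷ [])
      ∷ [])
    ∷ ( ((+ 0 , + 0) ∷ (+ 0 , + 0) ∷ (+ 0 , + 0) ∷ (-[1+ 1 ] , -[1+ 1 ]) ∷ (+ 0 , + 0) ∷ (+ 0 , + 0) ∷ (+ 0 , + 0) ∷ (+ 0 , + 0) ∷ [])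
      ∷ ((+ 0 , + 0) ∷ (-[1+ 1 ] , -[1+ 1 ]) ∷ (+ 0 , + 0) ∷ (+ 0 , + 0) ∷ (+ 0 , + 0) ∷ (+ 0 , + 0) ∷ (+ 0 , + 0) ∷ (+ 0 , + 0) ∷ [])
      ∷ ((+ 0 , + 0) ∷ (+ 0 , + 0) ∷ (+ 0 , + 0) ∷ (+ 0 , + 0) ∷ (+ 0 , + 0) ∷ (+ 0 , + 0) ∷ (+ 2 , -[1+ 1 ]) ∷ (+ 0 , + 0) ∷ [])
      ∷ ((+ 0 , + 0) ∷ (+ 0 , + 0) ∷ (+ 0 , + 0) ∷ (+ 0 , + 0) ∷ (-[1+ 1 ] , + 2) ∷ (+ 0 , + 0) ∷ (+ 0 , + 0) ∷ (+ 0 , + 0) ∷ [])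
      ∷ ((+ 0 , + 0) ∷ (+ 1 , -[1+ 0 ]) ∷ (-[1+ 0 ] , + 1) ∷ (+ 0 , + 0) ∷ (+ 1 , + 1) ∷ (+ 0 , -[1+ 1 ]) ∷ (+ 0 , + 0) ∷ (+ 1 , -[1+ 0 ]) ∷ [])
      ∷ [])
    ∷ ( ((+ 0 , + 0) ∷ (+ 0 , + 0) ∷ (+ 0 , + 0) ∷ (+ 0 , + 0) ∷ (-[1+ 1 ] , + 2) ∷ (+ 0 , + 0) ∷ (+ 0 , + 0) ∷ (+ 0 , + 0) ∷ [])
      ∷ ((+ 0 , + 0) ∷ (+ 0 , + 0) ∷ (+ 0 , + 0) ∷ (+ 0 , + 0) ∷ (+ 0 , + 0) ∷ (+ 0 , + 0) ∷ (+ 2 , -[1+ 1 ]) ∷ (+ 0 , + 0) ∷ [])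
      ∷ ((+ 0 , + 0) ∷ (+ 2 , + 2) ∷ (+ 0 , + 0) ∷ (+ 0 , + 0) ∷ (+ 0 , + 0) ∷ (+ 0 , + 0) ∷ (+ 0 , + 0) ∷ (+ 0 , + 0) ∷ [])
      ∷ ((+ 0 , + 0) ∷ (+ 0 , + 0) ∷ (+ 0 , + 0) ∷ (+ 2 , + 2) ∷ (+ 0 , + 0) ∷ (+ 0 , + 0) ∷ (+ 0 , + 0) ∷ (+ 0 , + 0) ∷ [])
      ∷ ((-[1+ 0 ] , -[1+ 0 ]) ∷ (+ 0 , + 0) ∷ (+ 0 , + 2) ∷ (-[1+ 0 ] , + 1) ∷ (+ 0 , + 0) ∷ (+ 1 , + 1) ∷ (+ 1 , + 1) ∷ (+ 0 , + 0) ∷ [])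
      ∷ [])
    ∷ ( ((+ 0 , + 0) ∷ (+ 0 , + 0) ∷ (+ 0 , + 0) ∷ (+ 0 , + 0) ∷ (-[1+ 1 ] , -[1+ 1 ]) ∷ (+ 0 , + 0) ∷ (+ 0 , + 0) ∷ (+ 0 , + 0) ∷ [])
      ∷ ((-[1+ 1 ] , -[1+ 1 ]) ∷ (+ 0 , + 0) ∷ (+ 0 , + 0) ∷ (+ 0 , + 0) ∷ (+ 0 , + 0) ∷ (+ 0 , + 0) ∷ (+ 0 , + 0) ∷ (+ 0 , + 0) ∷ [])
      ∷ ((+ 0 , + 0) ∷ (+ 0 , + 0) ∷ (+ 0 , + 0) ∷ (+ 0 , + 0) ∷ (+ 0 , + 0) ∷ (+ 0 , + 0) ∷ (+ 0 , + 0) ∷ (+ 2 , -[1+ 1 ]) ∷ [])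
      ∷ ((+ 0 , + 0) ∷ (+ 0 , + 0) ∷ (+ 0 , + 0) ∷ (+ 0 , + 0) ∷ (+ 0 , + 0) ∷ (+ 0 , + 0) ∷ (+ 2 , + 2) ∷ (+ 0 , + 0) ∷ [])
      ∷ ((+ 1 , -[1+ 0 ]) ∷ (+ 0 , + 0) ∷ (-[1+ 1 ] , + 0) ∷ (-[1+ 0 ] , -[1+ 0 ]) ∷ (+ 0 , + 0) ∷ (-[1+ 0 ] , + 1) ∷ (-[1+ 0 ] , + 1) ∷ (+ 0 , + 0) ∷ [])
      ∷ [])
    ∷ ( ((+ 0 , + 0) ∷ (+ 0 , + 0) ∷ (+ 0 , + 0) ∷ (+ 0 , + 0) ∷ (+ 0 , + 0) ∷ (-[1+ 1 ] , + 2) ∷ (+ 0 , + 0) ∷ (+ 0 , + 0) ∷ [])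
      ∷ ((+ 0 , + 0) ∷ (+ 0 , + 0) ∷ (+ 0 , + 0) ∷ (+ 0 , + 0) ∷ (+ 0 , + 0) ∷ (+ 0 , + 0) ∷ (-[1+ 1 ] , -[1+ 1 ]) ∷ (+ 0 , + 0) ∷ [])
      ∷ ((+ 0 , + 0) ∷ (-[1+ 1 ] , + 2) ∷ (+ 0 , + 0) ∷ (+ 0 , + 0) ∷ (+ 0 , + 0) ∷ (+ 0 , + 0) ∷ (+ 0 , + 0) ∷ (+ 0 , + 0) ∷ [])
      ∷ ((-[1+ 1 ] , -[1+ 1 ]) ∷ (+ 0 , + 0) ∷ (+ 0 , + 0) ∷ (+ 0 , + 0) ∷ (+ 0 , + 0) ∷ (+ 0 , + 0) ∷ (+ 0 , + 0) ∷ (+ 0 , + 0) ∷ [])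
      ∷ ((+ 0 , + 0) ∷ (+ 0 , + 0) ∷ (+ 0 , + 0) ∷ (+ 0 , -[1+ 1 ]) ∷ (+ 1 , + 1) ∷ (+ 1 , + 1) ∷ (+ 1 , -[1+ 0 ]) ∷ (-[1+ 0 ] , -[1+ 0 ]) ∷ [])
      ∷ [])
    ∷ ( ((+ 0 , + 0) ∷ (+ 0 , + 0) ∷ (+ 0 , + 0) ∷ (+ 0 , + 0) ∷ (+ 0 , + 0) ∷ (-[1+ 1 ] , -[1+ 1 ]) ∷ (+ 0 , + 0) ∷ (+ 0 , + 0) ∷ [])
      ∷ ((+ 0 , + 0) ∷ (+ 0 , + 0) ∷ (+ 0 , + 0) ∷ (+ 0 , + 0) ∷ (+ 0 , + 0) ∷ (+ 0 , + 0) ∷ (+ 0 , + 0) ∷ (-[1+ 1 ] , -[1+ 1 ]) ∷ [])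
      ∷ ((-[1+ 1 ] , + 2) ∷ (+ 0 , + 0) ∷ (+ 0 , + 0) ∷ (+ 0 , + 0) ∷ (+ 0 , + 0) ∷ (+ 0 , + 0) ∷ (+ 0 , + 0) ∷ (+ 0 , + 0) ∷ [])
      ∷ ((+ 0 , + 0) ∷ (+ 0 , + 0) ∷ (+ 2 , -[1+ 1 ]) ∷ (+ 0 , + 0) ∷ (+ 0 , + 0) ∷ (+ 0 , + 0) ∷ (+ 0 , + 0) ∷ (+ 0 , + 0) ∷ [])
      ∷ ((+ 0 , + 0) ∷ (+ 0 , + 0) ∷ (+ 0 , + 0) ∷ (+ 2 , + 0) ∷ (-[1+ 0 ] , + 1) ∷ (-[1+ 0 ] , + 1) ∷ (+ 1 , + 1) ∷ (+ 1 , -[1+ 0 ]) ∷ [])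
      ∷ [])
    ∷ ( ((+ 0 , + 0) ∷ (+ 0 , + 0) ∷ (+ 0 , + 0) ∷ (+ 0 , + 0) ∷ (+ 0 , + 0) ∷ (+ 0 , + 0) ∷ (-[1+ 1 ] , + 2) ∷ (+ 0 , + 0) ∷ [])
      ∷ ((+ 0 , + 0) ∷ (+ 0 , + 0) ∷ (+ 0 , + 0) ∷ (+ 0 , + 0) ∷ (-[1+ 1 ] , + 2) ∷ (+ 0 , + 0) ∷ (+ 0 , + 0) ∷ (+ 0 , + 0) ∷ [])
      ∷ ((+ 0 , + 0) ∷ (+ 0 , + 0) ∷ (+ 0 , + 0) ∷ (-[1+ 1 ] , -[1+ 1 ]) ∷ (+ 0 , + 0) ∷ (+ 0 , + 0) ∷ (+ 0 , + 0) ∷ (+ 0 , + 0) ∷ [])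
      ∷ ((+ 0 , + 0) ∷ (+ 2 , + 2) ∷ (+ 0 , + 0) ∷ (+ 0 , + 0) ∷ (+ 0 , + 0) ∷ (+ 0 , + 0) ∷ (+ 0 , + 0) ∷ (+ 0 , + 0) ∷ [])
      ∷ ((-[1+ 0 ] , + 1) ∷ (+ 1 , -[1+ 0 ]) ∷ (+ 0 , + 0) ∷ (+ 0 , + 0) ∷ (+ 1 , + 1) ∷ (-[1+ 0 ] , + 1) ∷ (+ 0 , + 0) ∷ (+ 0 , + 2) ∷ [])
      ∷ [])
    ∷ ( ((+ 0 , + 0) ∷ (+ 0 , + 0) ∷ (+ 0 , + 0) ∷ (+ 0 , + 0) ∷ (+ 0 , + 0) ∷ (+ 0 , + 0) ∷ (-[1+ 1 ] , -[1+ 1 ]) ∷ (+ 0 , + 0) ∷ [])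
      ∷ ((+ 0 , + 0) ∷ (+ 0 , + 0) ∷ (+ 0 , + 0) ∷ (+ 0 , + 0) ∷ (+ 0 , + 0) ∷ (+ 2 , -[1+ 1 ]) ∷ (+ 0 , + 0) ∷ (+ 0 , + 0) ∷ [])
      ∷ ((+ 0 , + 0) ∷ (+ 0 , + 0) ∷ (-[1+ 1 ] , -[1+ 1 ]) ∷ (+ 0 , + 0) ∷ (+ 0 , + 0) ∷ (+ 0 , + 0) ∷ (+ 0 , + 0) ∷ (+ 0 , + 0) ∷ [])
      ∷ ((+ 0 , + 0) ∷ (+ 0 , + 0) ∷ (+ 0 , + 0) ∷ (+ 0 , + 0) ∷ (-[1+ 1 ] , -[1+ 1 ]) ∷ (+ 0 , + 0) ∷ (+ 0 , + 0) ∷ (+ 0 , + 0) ∷ [])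
      ∷ ((-[1+ 0 ] , -[1+ 0 ]) ∷ (+ 1 , + 1) ∷ (+ 0 , + 0) ∷ (+ 0 , + 0) ∷ (-[1+ 0 ] , + 1) ∷ (-[1+ 0 ] , -[1+ 0 ]) ∷ (+ 0 , + 0) ∷ (-[1+ 1 ] , + 0) ∷ [])
      ∷ [])
    ∷ ( ((+ 0 , + 0) ∷ (+ 0 , + 0) ∷ (+ 0 , + 0) ∷ (+ 0 , + 0) ∷ (+ 0 , + 0) ∷ (+ 0 , + 0) ∷ (+ 0 , + 0) ∷ (-[1+ 1 ] , + 2) ∷ [])
      ∷ ((+ 0 , + 0) ∷ (+ 0 , + 0) ∷ (+ 0 , + 0) ∷ (+ 2 , -[1+ 1 ]) ∷ (+ 0 , + 0) ∷ (+ 0 , + 0) ∷ (+ 0 , + 0) ∷ (+ 0 , + 0) ∷ [])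
      ∷ ((+ 0 , + 0) ∷ (+ 0 , + 0) ∷ (+ 0 , + 0) ∷ (+ 0 , + 0) ∷ (-[1+ 1 ] , -[1+ 1 ]) ∷ (+ 0 , + 0) ∷ (+ 0 , + 0) ∷ (+ 0 , + 0) ∷ [])
      ∷ ((+ 0 , + 0) ∷ (+ 0 , + 0) ∷ (+ 2 , + 2) ∷ (+ 0 , + 0) ∷ (+ 0 , + 0) ∷ (+ 0 , + 0) ∷ (+ 0 , + 0) ∷ (+ 0 , + 0) ∷ [])
      ∷ ((+ 0 , + 0) ∷ (-[1+ 0 ] , + 1) ∷ (+ 0 , + 0) ∷ (-[1+ 0 ] , -[1+ 0 ]) ∷ (+ 0 , + 0) ∷ (-[1+ 0 ] , -[1+ 0 ]) ∷ (+ 2 , + 0) ∷ (+ 1 , + 1) ∷ [])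
      ∷ [])
    ∷ ( ((+ 0 , + 0) ∷ (+ 0 , + 0) ∷ (+ 0 , + 0) ∷ (+ 0 , + 0) ∷ (+ 0 , + 0) ∷ (+ 0 , + 0) ∷ (+ 0 , + 0) ∷ (-[1+ 1 ] , -[1+ 1 ]) ∷ [])
      ∷ ((+ 0 , + 0) ∷ (+ 0 , + 0) ∷ (+ 0 , + 0) ∷ (+ 0 , + 0) ∷ (+ 0 , + 0) ∷ (+ 2 , + 2) ∷ (+ 0 , + 0) ∷ (+ 0 , + 0) ∷ [])
      ∷ ((+ 0 , + 0) ∷ (+ 0 , + 0) ∷ (-[1+ 1 ] , + 2) ∷ (+ 0 , + 0) ∷ (+ 0 , + 0) ∷ (+ 0 , + 0) ∷ (+ 0 , + 0) ∷ (+ 0 , + 0) ∷ [])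
      ∷ ((-[1+ 1 ] , + 2) ∷ (+ 0 , + 0) ∷ (+ 0 , + 0) ∷ (+ 0 , + 0) ∷ (+ 0 , + 0) ∷ (+ 0 , + 0) ∷ (+ 0 , + 0) ∷ (+ 0 , + 0) ∷ [])
      ∷ ((+ 0 , + 0) ∷ (-[1+ 0 ] , -[1+ 0 ]) ∷ (+ 0 , + 0) ∷ (+ 1 , -[1+ 0 ]) ∷ (+ 0 , + 0) ∷ (+ 1 , -[1+ 0 ]) ∷ (+ 0 , + 2) ∷ (-[1+ 0 ] , + 1) ∷ [])
      ∷ [])
    ∷ []

  Ctab : Vec (Vec (Vec ℤ[i] 8) 5) 16
  Ctab =
    ( ((-[1+ 1 ] , + 2) ∷ (+ 0 , -[1+ 1 ]) ∷ (+ 0 , -[1+ 1 ]) ∷ (+ 1 , + 1) ∷ (+ 0 , -[1+ 1 ]) ∷ (+ 1 , + 1) ∷ (+ 1 , + 1) ∷ (-[1+ 0 ] , + 0) ∷ [])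
      ∷ ((+ 0 , + 0) ∷ (+ 0 , + 0) ∷ (+ 0 , -[1+ 1 ]) ∷ (+ 1 , + 1) ∷ (+ 0 , + 0) ∷ (+ 0 , + 0) ∷ (+ 1 , + 1) ∷ (-[1+ 0 ] , + 0) ∷ [])
      ∷ ((+ 0 , + 0) ∷ (+ 0 , + 0) ∷ (+ 0 , + 0) ∷ (+ 0 , + 0) ∷ (+ 0 , + 0) ∷ (+ 1 , -[1+ 0 ]) ∷ (+ 0 , + 0) ∷ (+ 0 , + 1) ∷ [])
      ∷ ((+ 0 , + 0) ∷ (+ 0 , + 0) ∷ (+ 0 , + 0) ∷ (+ 0 , + 0) ∷ (+ 0 , + 0) ∷ (+ 0 , + 0) ∷ (+ 0 , + 0) ∷ (+ 0 , -[1+ 0 ]) ∷ [])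
      ∷ ((-[1+ 0 ] , -[1+ 0 ]) ∷ (+ 0 , -[1+ 0 ]) ∷ (+ 0 , + 0) ∷ (+ 1 , + 0) ∷ (+ 0 , + 0) ∷ (+ 1 , + 0) ∷ (+ 0 , -[1+ 0 ]) ∷ (+ 0 , + 1) ∷ [])
      ∷ [])
    ∷ ( ((-[1+ 1 ] , -[1+ 1 ]) ∷ (+ 2 , + 0) ∷ (+ 2 , + 0) ∷ (-[1+ 0 ] , + 1) ∷ (+ 2 , + 0) ∷ (-[1+ 0 ] , + 1) ∷ (-[1+ 0 ] , + 1) ∷ (+ 0 , -[1+ 0 ]) ∷ [])
      ∷ ((+ 0 , + 0) ∷ (+ 0 , + 0) ∷ (+ 0 , + 0) ∷ (+ 0 , + 0) ∷ (+ 2 , + 0) ∷ (-[1+ 0 ] , + 1) ∷ (-[1+ 0 ] , + 1) ∷ (+ 0 , -[1+ 0 ]) ∷ [])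
      ∷ ((+ 0 , + 0) ∷ (+ 0 , + 0) ∷ (+ 0 , + 0) ∷ (-[1+ 0 ] , -[1+ 0 ]) ∷ (+ 0 , + 0) ∷ (+ 0 , + 0) ∷ (+ 0 , + 0) ∷ (+ 1 , + 0) ∷ [])
      ∷ ((+ 0 , + 0) ∷ (+ 0 , + 0) ∷ (+ 0 , + 0) ∷ (+ 0 , + 0) ∷ (+ 0 , + 0) ∷ (-[1+ 0 ] , -[1+ 0 ]) ∷ (+ 0 , + 0) ∷ (+ 1 , + 0) ∷ [])
      ∷ ((+ 1 , -[1+ 0 ]) ∷ (+ 1 , + 0) ∷ (+ 0 , + 0) ∷ (+ 0 , + 1) ∷ (+ 0 , + 0) ∷ (+ 0 , + 1) ∷ (+ 1 , + 0) ∷ (-[1+ 0 ] , + 0) ∷ [])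
      ∷ [])
    ∷ ( ((+ 0 , + 0) ∷ (+ 0 , + 2) ∷ (+ 0 , + 0) ∷ (-[1+ 0 ] , -[1+ 0 ]) ∷ (+ 0 , + 0) ∷ (-[1+ 0 ] , -[1+ 0 ]) ∷ (+ 0 , + 0) ∷ (+ 1 , + 0) ∷ [])
      ∷ ((+ 0 , + 0) ∷ (+ 0 , + 0) ∷ (+ 2 , + 0) ∷ (-[1+ 0 ] , + 1) ∷ (+ 0 , + 0) ∷ (+ 0 , + 0) ∷ (-[1+ 0 ] , + 1) ∷ (+ 0 , -[1+ 0 ]) ∷ [])
      ∷ ((+ 0 , + 0) ∷ (+ 0 , + 0) ∷ (+ 0 , + 0) ∷ (+ 0 , + 0) ∷ (+ 0 , + 0) ∷ (-[1+ 0 ] , -[1+ 0 ]) ∷ (+ 0 , + 0) ∷ (+ 1 , + 0) ∷ [])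
      ∷ ((+ 0 , + 0) ∷ (+ 0 , + 0) ∷ (+ 0 , + 0) ∷ (+ 1 , + 1) ∷ (+ 0 , + 0) ∷ (+ 0 , + 0) ∷ (+ 0 , + 0) ∷ (-[1+ 0 ] , + 0) ∷ [])
      ∷ ((-[1+ 1 ] , + 0) ∷ (+ 1 , -[1+ 0 ]) ∷ (+ 1 , -[1+ 1 ]) ∷ (+ 0 , + 2) ∷ (+ 1 , -[1+ 0 ]) ∷ (+ 0 , + 1) ∷ (+ 1 , + 2) ∷ (-[1+ 1 ] , -[1+ 0 ]) ∷ [])
      ∷ [])
    ∷ ( ((+ 0 , + 0) ∷ (-[1+ 1 ] , + 0) ∷ (+ 0 , + 0) ∷ (+ 1 , -[1+ 0 ]) ∷ (+ 0 , + 0) ∷ (+ 1 , -[1+ 0 ]) ∷ (+ 0 , + 0) ∷ (+ 0 , + 1) ∷ [])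
      ∷ ((+ 0 , + 0) ∷ (+ 0 , + 0) ∷ (+ 0 , + 0) ∷ (+ 1 , -[1+ 0 ]) ∷ (+ 0 , + 0) ∷ (+ 0 , + 0) ∷ (+ 0 , + 0) ∷ (+ 0 , + 1) ∷ [])
      ∷ ((+ 0 , + 0) ∷ (+ 0 , + 0) ∷ (+ 0 , + 0) ∷ (+ 0 , + 0) ∷ (+ 0 , + 2) ∷ (-[1+ 0 ] , -[1+ 0 ]) ∷ (-[1+ 0 ] , -[1+ 0 ]) ∷ (+ 1 , + 0) ∷ [])
      ∷ ((+ 0 , + 0) ∷ (+ 0 , + 0) ∷ (+ 0 , + 0) ∷ (+ 0 , + 0) ∷ (+ 0 , + 0) ∷ (+ 0 , + 0) ∷ (+ 1 , + 1) ∷ (-[1+ 0 ] , + 0) ∷ [])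
      ∷ ((+ 0 , -[1+ 1 ]) ∷ (+ 1 , + 1) ∷ (+ 2 , + 1) ∷ (-[1+ 1 ] , + 0) ∷ (+ 1 , + 1) ∷ (-[1+ 0 ] , + 0) ∷ (-[1+ 1 ] , + 1) ∷ (+ 1 , -[1+ 1 ]) ∷ [])
      ∷ [])
    ∷ ( ((+ 0 , + 0) ∷ (+ 0 , + 0) ∷ (+ 0 , + 2) ∷ (-[1+ 0 ] , -[1+ 0 ]) ∷ (+ 0 , + 0) ∷ (+ 0 , + 0) ∷ (-[1+ 0 ] , -[1+ 0 ]) ∷ (+ 1 , + 0) ∷ [])
      ∷ ((-[1+ 1 ] , + 2) ∷ (+ 0 , -[1+ 1 ]) ∷ (+ 0 , -[1+ 1 ]) ∷ (+ 1 , + 1) ∷ (+ 0 , -[1+ 1 ]) ∷ (+ 1 , + 1) ∷ (+ 1 , + 1) ∷ (-[1+ 0 ] , + 0) ∷ [])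
      ∷ ((+ 0 , + 0) ∷ (+ 0 , + 0) ∷ (+ 0 , + 0) ∷ (+ 0 , + 0) ∷ (+ 0 , + 0) ∷ (+ 0 , + 0) ∷ (+ 0 , + 0) ∷ (+ 0 , -[1+ 0 ]) ∷ [])
      ∷ ((+ 0 , + 0) ∷ (+ 0 , + 0) ∷ (+ 0 , + 0) ∷ (+ 0 , + 0) ∷ (+ 0 , + 0) ∷ (-[1+ 0 ] , + 1) ∷ (+ 0 , + 0) ∷ (+ 0 , -[1+ 0 ]) ∷ [])
      ∷ ((-[1+ 0 ] , -[1+ 0 ]) ∷ (+ 1 , + 1) ∷ (+ 0 , + 0) ∷ (+ 0 , -[1+ 0 ]) ∷ (+ 2 , -[1+ 0 ]) ∷ (-[1+ 0 ] , + 1) ∷ (+ 0 , + 1) ∷ (+ 0 , + 0) ∷ [])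
      ∷ [])
    ∷ ( ((+ 0 , + 0) ∷ (+ 0 , + 0) ∷ (-[1+ 1 ] , + 0) ∷ (+ 1 , -[1+ 0 ]) ∷ (+ 0 , + 0) ∷ (+ 0 , + 0) ∷ (+ 1 , -[1+ 0 ]) ∷ (+ 0 , + 1) ∷ [])
      ∷ ((+ 0 , + 0) ∷ (+ 0 , + 2) ∷ (+ 0 , + 0) ∷ (-[1+ 0 ] , -[1+ 0 ]) ∷ (+ 0 , + 0) ∷ (-[1+ 0 ] , -[1+ 0 ]) ∷ (+ 0 , + 0) ∷ (+ 1 , + 0) ∷ [])
      ∷ ((+ 0 , + 0) ∷ (+ 0 , + 0) ∷ (+ 0 , + 0) ∷ (+ 0 , + 0) ∷ (+ 0 , + 0) ∷ (+ 0 , + 0) ∷ (+ 1 , -[1+ 0 ]) ∷ (+ 0 , + 1) ∷ [])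
      ∷ ((+ 0 , + 0) ∷ (+ 0 , + 0) ∷ (+ 0 , + 0) ∷ (+ 0 , + 0) ∷ (+ 0 , + 0) ∷ (+ 0 , + 0) ∷ (+ 0 , + 0) ∷ (+ 1 , + 0) ∷ [])
      ∷ ((+ 1 , -[1+ 0 ]) ∷ (-[1+ 0 ] , + 1) ∷ (+ 0 , + 0) ∷ (+ 1 , + 0) ∷ (+ 1 , + 2) ∷ (-[1+ 0 ] , -[1+ 0 ]) ∷ (-[1+ 0 ] , + 0) ∷ (+ 0 , + 0) ∷ [])
      ∷ [])
    ∷ ( ((+ 0 , + 0) ∷ (+ 0 , + 0) ∷ (+ 0 , + 0) ∷ (+ 1 , + 1) ∷ (+ 0 , + 0) ∷ (+ 0 , + 0) ∷ (+ 0 , + 0) ∷ (-[1+ 0 ] , + 0) ∷ [])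
      ∷ ((+ 0 , + 0) ∷ (+ 0 , + 0) ∷ (+ 0 , + 0) ∷ (+ 0 , + 0) ∷ (+ 0 , + 0) ∷ (+ 0 , + 0) ∷ (+ 0 , + 0) ∷ (+ 1 , + 0) ∷ [])
      ∷ ((-[1+ 1 ] , -[1+ 1 ]) ∷ (+ 2 , + 0) ∷ (+ 2 , + 0) ∷ (-[1+ 0 ] , + 1) ∷ (+ 2 , + 0) ∷ (-[1+ 0 ] , + 1) ∷ (-[1+ 0 ] , + 1) ∷ (+ 0 , -[1+ 0 ]) ∷ [])
      ∷ ((+ 0 , + 0) ∷ (+ 0 , -[1+ 1 ]) ∷ (+ 0 , + 0) ∷ (+ 1 , + 1) ∷ (+ 0 , + 0) ∷ (+ 1 , + 1) ∷ (+ 0 , + 0) ∷ (-[1+ 0 ] , + 0) ∷ [])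
      ∷ ((+ 0 , + 0) ∷ (-[1+ 0 ] , + 0) ∷ (+ 1 , + 0) ∷ (+ 0 , + 0) ∷ (+ 0 , -[1+ 0 ]) ∷ (+ 1 , + 1) ∷ (+ 0 , + 1) ∷ (-[1+ 0 ] , + 0) ∷ [])
      ∷ [])
    ∷ ( ((+ 0 , + 0) ∷ (+ 0 , + 0) ∷ (+ 0 , + 0) ∷ (-[1+ 0 ] , + 1) ∷ (+ 0 , + 0) ∷ (+ 0 , + 0) ∷ (+ 0 , + 0) ∷ (+ 0 , -[1+ 0 ]) ∷ [])
      ∷ ((+ 0 , + 0) ∷ (-[1+ 1 ] , + 0) ∷ (+ 0 , + 0) ∷ (+ 1 , -[1+ 0 ]) ∷ (+ 0 , + 0) ∷ (+ 1 , -[1+ 0 ]) ∷ (+ 0 , + 0) ∷ (+ 0 , + 1) ∷ [])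
      ∷ ((+ 0 , + 0) ∷ (+ 0 , + 0) ∷ (+ 0 , + 0) ∷ (+ 0 , + 0) ∷ (+ 0 , + 0) ∷ (+ 0 , + 0) ∷ (-[1+ 0 ] , -[1+ 0 ]) ∷ (+ 1 , + 0) ∷ [])
      ∷ ((+ 0 , + 0) ∷ (+ 0 , + 0) ∷ (+ 0 , + 0) ∷ (+ 0 , + 0) ∷ (+ 0 , + 2) ∷ (-[1+ 0 ] , -[1+ 0 ]) ∷ (-[1+ 0 ] , -[1+ 0 ]) ∷ (+ 1 , + 0) ∷ [])
      ∷ ((+ 0 , + 0) ∷ (+ 0 , -[1+ 0 ]) ∷ (+ 0 , + 1) ∷ (+ 0 , + 0) ∷ (+ 1 , + 0) ∷ (-[1+ 0 ] , + 1) ∷ (-[1+ 0 ] , + 0) ∷ (+ 0 , -[1+ 0 ]) ∷ [])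
      ∷ [])
    ∷ ( ((+ 0 , + 0) ∷ (+ 0 , + 0) ∷ (+ 0 , + 0) ∷ (+ 0 , + 0) ∷ (+ 0 , + 2) ∷ (-[1+ 0 ] , -[1+ 0 ]) ∷ (-[1+ 0 ] , -[1+ 0 ]) ∷ (+ 1 , + 0) ∷ [])
      ∷ ((+ 0 , + 0) ∷ (+ 0 , + 0) ∷ (+ 0 , + 0) ∷ (+ 0 , + 0) ∷ (+ 0 , + 0) ∷ (+ 0 , + 0) ∷ (-[1+ 0 ] , -[1+ 0 ]) ∷ (+ 1 , + 0) ∷ [])
      ∷ ((+ 0 , + 0) ∷ (+ 2 , + 0) ∷ (+ 0 , + 0) ∷ (-[1+ 0 ] , + 1) ∷ (+ 0 , + 0) ∷ (-[1+ 0 ] , + 1) ∷ (+ 0 , + 0) ∷ (+ 0 , -[1+ 0 ]) ∷ [])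
      ∷ ((+ 0 , + 0) ∷ (+ 0 , + 0) ∷ (+ 0 , + 0) ∷ (+ 1 , -[1+ 0 ]) ∷ (+ 0 , + 0) ∷ (+ 0 , + 0) ∷ (+ 0 , + 0) ∷ (+ 0 , + 1) ∷ [])
      ∷ ((-[1+ 0 ] , -[1+ 0 ]) ∷ (+ 1 , + 0) ∷ (+ 2 , + 1) ∷ (-[1+ 0 ] , + 1) ∷ (+ 1 , + 0) ∷ (+ 0 , + 0) ∷ (-[1+ 0 ] , + 0) ∷ (+ 0 , + 0) ∷ [])
      ∷ [])
    ∷ ( ((+ 0 , + 0) ∷ (+ 0 , + 0) ∷ (+ 0 , + 0) ∷ (+ 0 , + 0) ∷ (-[1+ 1 ] , + 0) ∷ (+ 1 , -[1+ 0 ]) ∷ (+ 1 , -[1+ 0 ]) ∷ (+ 0 , + 1) ∷ [])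
      ∷ ((-[1+ 1 ] , -[1+ 1 ]) ∷ (+ 2 , + 0) ∷ (+ 2 , + 0) ∷ (-[1+ 0 ] , + 1) ∷ (+ 2 , + 0) ∷ (-[1+ 0 ] , + 1) ∷ (-[1+ 0 ] , + 1) ∷ (+ 0 , -[1+ 0 ]) ∷ [])
      ∷ ((+ 0 , + 0) ∷ (+ 0 , + 0) ∷ (+ 0 , + 0) ∷ (+ 0 , + 0) ∷ (+ 0 , + 0) ∷ (+ 0 , + 0) ∷ (+ 0 , + 0) ∷ (-[1+ 0 ] , + 0) ∷ [])
      ∷ ((+ 0 , + 0) ∷ (+ 0 , + 0) ∷ (+ 0 , + 0) ∷ (+ 0 , + 0) ∷ (+ 0 , + 0) ∷ (+ 0 , + 0) ∷ (+ 1 , -[1+ 0 ]) ∷ (+ 0 , + 1) ∷ [])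
      ∷ ((+ 1 , -[1+ 0 ]) ∷ (+ 0 , + 1) ∷ (-[1+ 0 ] , + 2) ∷ (-[1+ 0 ] , -[1+ 0 ]) ∷ (+ 0 , + 1) ∷ (+ 0 , + 0) ∷ (+ 0 , -[1+ 0 ]) ∷ (+ 0 , + 0) ∷ [])
      ∷ [])
    ∷ ( ((+ 0 , + 0) ∷ (+ 0 , + 0) ∷ (+ 0 , + 0) ∷ (+ 0 , + 0) ∷ (+ 0 , + 0) ∷ (+ 1 , + 1) ∷ (+ 0 , + 0) ∷ (-[1+ 0 ] , + 0) ∷ [])
      ∷ ((+ 0 , + 0) ∷ (+ 0 , + 0) ∷ (+ 0 , + 0) ∷ (+ 0 , + 0) ∷ (+ 0 , + 0) ∷ (+ 0 , + 0) ∷ (-[1+ 0 ] , + 1) ∷ (+ 0 , -[1+ 0 ]) ∷ [])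
      ∷ ((+ 0 , + 0) ∷ (+ 0 , + 2) ∷ (+ 0 , + 0) ∷ (-[1+ 0 ] , -[1+ 0 ]) ∷ (+ 0 , + 0) ∷ (-[1+ 0 ] , -[1+ 0 ]) ∷ (+ 0 , + 0) ∷ (+ 1 , + 0) ∷ [])
      ∷ ((-[1+ 1 ] , -[1+ 1 ]) ∷ (+ 2 , + 0) ∷ (+ 2 , + 0) ∷ (-[1+ 0 ] , + 1) ∷ (+ 2 , + 0) ∷ (-[1+ 0 ] , + 1) ∷ (-[1+ 0 ] , + 1) ∷ (+ 0 , -[1+ 0 ]) ∷ [])
      ∷ ((+ 0 , + 0) ∷ (+ 0 , + 0) ∷ (+ 0 , + 0) ∷ (-[1+ 0 ] , + 0) ∷ (+ 1 , + 0) ∷ (+ 0 , + 0) ∷ (-[1+ 0 ] , + 0) ∷ (+ 1 , + 0) ∷ [])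
      ∷ [])
    ∷ ( ((+ 0 , + 0) ∷ (+ 0 , + 0) ∷ (+ 0 , + 0) ∷ (+ 0 , + 0) ∷ (+ 0 , + 0) ∷ (-[1+ 0 ] , + 1) ∷ (+ 0 , + 0) ∷ (+ 0 , -[1+ 0 ]) ∷ [])
      ∷ ((+ 0 , + 0) ∷ (+ 0 , + 0) ∷ (+ 0 , + 0) ∷ (+ 0 , + 0) ∷ (+ 0 , + 0) ∷ (+ 0 , + 0) ∷ (+ 0 , + 0) ∷ (+ 0 , + 1) ∷ [])
      ∷ ((-[1+ 1 ] , + 2) ∷ (+ 0 , -[1+ 1 ]) ∷ (+ 0 , -[1+ 1 ]) ∷ (+ 1 , + 1) ∷ (+ 0 , -[1+ 1 ]) ∷ (+ 1 , + 1) ∷ (+ 1 , + 1) ∷ (-[1+ 0 ] , + 0) ∷ [])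
      ∷ ((+ 0 , + 0) ∷ (+ 0 , + 0) ∷ (+ 0 , -[1+ 1 ]) ∷ (+ 1 , + 1) ∷ (+ 0 , + 0) ∷ (+ 0 , + 0) ∷ (+ 1 , + 1) ∷ (-[1+ 0 ] , + 0) ∷ [])
      ∷ ((+ 0 , + 0) ∷ (+ 0 , + 0) ∷ (+ 0 , + 0) ∷ (+ 0 , -[1+ 0 ]) ∷ (+ 0 , + 1) ∷ (+ 0 , + 0) ∷ (+ 0 , -[1+ 0 ]) ∷ (+ 0 , + 1) ∷ [])
      ∷ [])
    ∷ ( ((+ 0 , + 0) ∷ (+ 0 , + 0) ∷ (+ 0 , + 0) ∷ (+ 0 , + 0) ∷ (+ 0 , + 0) ∷ (+ 0 , + 0) ∷ (+ 1 , + 1) ∷ (-[1+ 0 ] , + 0) ∷ [])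
      ∷ ((+ 0 , + 0) ∷ (+ 0 , + 0) ∷ (+ 0 , + 0) ∷ (+ 0 , + 0) ∷ (+ 0 , + 2) ∷ (-[1+ 0 ] , -[1+ 0 ]) ∷ (-[1+ 0 ] , -[1+ 0 ]) ∷ (+ 1 , + 0) ∷ [])
      ∷ ((+ 0 , + 0) ∷ (+ 0 , + 0) ∷ (+ 0 , + 0) ∷ (-[1+ 0 ] , + 1) ∷ (+ 0 , + 0) ∷ (+ 0 , + 0) ∷ (+ 0 , + 0) ∷ (+ 0 , -[1+ 0 ]) ∷ [])
      ∷ ((+ 0 , + 0) ∷ (+ 2 , + 0) ∷ (+ 0 , + 0) ∷ (-[1+ 0 ] , + 1) ∷ (+ 0 , + 0) ∷ (-[1+ 0 ] , + 1) ∷ (+ 0 , + 0) ∷ (+ 0 , -[1+ 0 ]) ∷ [])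
      ∷ ((-[1+ 0 ] , + 1) ∷ (+ 0 , -[1+ 1 ]) ∷ (+ 0 , -[1+ 0 ]) ∷ (+ 1 , + 1) ∷ (+ 1 , -[1+ 0 ]) ∷ (+ 1 , + 2) ∷ (+ 0 , + 1) ∷ (-[1+ 0 ] , -[1+ 0 ]) ∷ [])
      ∷ [])
    ∷ ( ((+ 0 , + 0) ∷ (+ 0 , + 0) ∷ (+ 0 , + 0) ∷ (+ 0 , + 0) ∷ (+ 0 , + 0) ∷ (+ 0 , + 0) ∷ (-[1+ 0 ] , + 1) ∷ (+ 0 , -[1+ 0 ]) ∷ [])
      ∷ ((+ 0 , + 0) ∷ (+ 0 , + 0) ∷ (+ 0 , + 0) ∷ (+ 0 , + 0) ∷ (+ 0 , + 0) ∷ (-[1+ 0 ] , -[1+ 0 ]) ∷ (+ 0 , + 0) ∷ (+ 1 , + 0) ∷ [])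
      ∷ ((+ 0 , + 0) ∷ (+ 0 , + 0) ∷ (-[1+ 1 ] , + 0) ∷ (+ 1 , -[1+ 0 ]) ∷ (+ 0 , + 0) ∷ (+ 0 , + 0) ∷ (+ 1 , -[1+ 0 ]) ∷ (+ 0 , + 1) ∷ [])
      ∷ ((+ 0 , + 0) ∷ (+ 0 , + 0) ∷ (+ 0 , + 0) ∷ (+ 0 , + 0) ∷ (-[1+ 1 ] , + 0) ∷ (+ 1 , -[1+ 0 ]) ∷ (+ 1 , -[1+ 0 ]) ∷ (+ 0 , + 1) ∷ [])
      ∷ ((-[1+ 0 ] , -[1+ 0 ]) ∷ (+ 2 , + 0) ∷ (+ 1 , + 0) ∷ (-[1+ 0 ] , + 1) ∷ (+ 1 , + 1) ∷ (-[1+ 1 ] , + 1) ∷ (-[1+ 0 ] , + 0) ∷ (+ 1 , -[1+ 0 ]) ∷ [])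
      ∷ [])
    ∷ ( ((+ 0 , + 0) ∷ (+ 0 , + 0) ∷ (+ 0 , + 0) ∷ (+ 0 , + 0) ∷ (+ 0 , + 0) ∷ (+ 0 , + 0) ∷ (+ 0 , + 0) ∷ (+ 1 , + 0) ∷ [])
      ∷ ((+ 0 , + 0) ∷ (+ 0 , + 0) ∷ (+ 0 , + 0) ∷ (-[1+ 0 ] , -[1+ 0 ]) ∷ (+ 0 , + 0) ∷ (+ 0 , + 0) ∷ (+ 0 , + 0) ∷ (+ 1 , + 0) ∷ [])
      ∷ ((+ 0 , + 0) ∷ (+ 0 , + 0) ∷ (+ 0 , + 0) ∷ (+ 0 , + 0) ∷ (-[1+ 1 ] , + 0) ∷ (+ 1 , -[1+ 0 ]) ∷ (+ 1 , -[1+ 0 ]) ∷ (+ 0 , + 1) ∷ [])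
      ∷ ((+ 0 , + 0) ∷ (+ 0 , + 0) ∷ (+ 2 , + 0) ∷ (-[1+ 0 ] , + 1) ∷ (+ 0 , + 0) ∷ (+ 0 , + 0) ∷ (-[1+ 0 ] , + 1) ∷ (+ 0 , -[1+ 0 ]) ∷ [])
      ∷ ((+ 0 , + 0) ∷ (+ 0 , + 1) ∷ (+ 0 , + 0) ∷ (-[1+ 0 ] , + 0) ∷ (+ 0 , + 0) ∷ (-[1+ 0 ] , + 0) ∷ (+ 0 , -[1+ 0 ]) ∷ (+ 1 , -[1+ 0 ]) ∷ [])
      ∷ [])
    ∷ ( ((+ 0 , + 0) ∷ (+ 0 , + 0) ∷ (+ 0 , + 0) ∷ (+ 0 , + 0) ∷ (+ 0 , + 0) ∷ (+ 0 , + 0) ∷ (+ 0 , + 0) ∷ (+ 0 , + 1) ∷ [])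
      ∷ ((+ 0 , + 0) ∷ (+ 0 , + 0) ∷ (+ 0 , + 0) ∷ (+ 0 , + 0) ∷ (+ 0 , + 0) ∷ (+ 1 , -[1+ 0 ]) ∷ (+ 0 , + 0) ∷ (+ 0 , + 1) ∷ [])
      ∷ ((+ 0 , + 0) ∷ (+ 0 , + 0) ∷ (+ 0 , + 2) ∷ (-[1+ 0 ] , -[1+ 0 ]) ∷ (+ 0 , + 0) ∷ (+ 0 , + 0) ∷ (-[1+ 0 ] , -[1+ 0 ]) ∷ (+ 1 , + 0) ∷ [])
      ∷ ((-[1+ 1 ] , + 2) ∷ (+ 0 , -[1+ 1 ]) ∷ (+ 0 , -[1+ 1 ]) ∷ (+ 1 , + 1) ∷ (+ 0 , -[1+ 1 ]) ∷ (+ 1 , + 1) ∷ (+ 1 , + 1) ∷ (-[1+ 0 ] , + 0) ∷ [])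
      ∷ ((+ 0 , + 0) ∷ (-[1+ 0 ] , + 0) ∷ (+ 0 , + 0) ∷ (+ 0 , -[1+ 0 ]) ∷ (+ 0 , + 0) ∷ (+ 0 , -[1+ 0 ]) ∷ (+ 1 , + 0) ∷ (+ 1 , + 1) ∷ [])
      ∷ [])
    ∷ []

  wordIndex : Vec Bool 3 → Fin 8
  wordIndex (false ∷ false ∷ false ∷ []) = # 0
  wordIndex (false ∷ false ∷ true  ∷ []) = # 1
  wordIndex (false ∷ true  ∷ false ∷ []) = # 2
  wordIndex (false ∷ true  ∷ true  ∷ []) = # 3
  wordIndex (true  ∷ false ∷ false ∷ []) = # 4
  wordIndex (true  ∷ false ∷ true  ∷ []) = # 5
  wordIndex (true  ∷ true  ∷ false ∷ []) = # 6
  wordIndex (true  ∷ true  ∷ true  ∷ []) = # 7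

  B C : Fin 16 → Fin 5 → V 3
  B r k w = lookup (lookup (lookup Btab r) k) (wordIndex w)
  C r k w = lookup (lookup (lookup Ctab r) k) (wordIndex w)

  InBW-B : ∀ r k → InBW 3 (B r k)
  InBW-B r k = C r k , B≗combRows r k
    where
    B≗combRows : ∀ r k → B r k ≗ combRows 3 (C r k)
    B≗combRows = toWitness {a? = all? λ r → all? λ k → ∀-words? λ w → B r k w ≟ᵍ combRows 3 (C r k) w} tt

  -- The diagonal and symmetrised off-diagonal entries determine the quadratic form of a 5 × 5 matrix.
  symmetrised : (Fin 5 → Fin 5 → ℤ) → Vec ℤ 15
  symmetrised G =
    G (# 0) (# 0) ∷ G (# 1) (# 1) ∷ G (# 2) (# 2) ∷ G (# 3) (# 3) ∷ G (# 4) (# 4) ∷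
    (G (# 0) (# 1) + G (# 1) (# 0)) ∷ (G (# 0) (# 2) + G (# 2) (# 0)) ∷ (G (# 0) (# 3) + G (# 3) (# 0)) ∷
    (G (# 0) (# 4) + G (# 4) (# 0)) ∷ (G (# 1) (# 2) + G (# 2) (# 1)) ∷ (G (# 1) (# 3) + G (# 3) (# 1)) ∷
    (G (# 1) (# 4) + G (# 4) (# 1)) ∷ (G (# 2) (# 3) + G (# 3) (# 2)) ∷ (G (# 2) (# 4) + G (# 4) (# 2)) ∷
    (G (# 3) (# 4) + G (# 4) (# 3)) ∷ []

  quadForm : Vec ℤ 5 → Vec ℤ 15 → ℤ
  quadForm (x0 ∷ x1 ∷ x2 ∷ x3 ∷ x4 ∷ []) (s0 ∷ s1 ∷ s2 ∷ s3 ∷ s4 ∷ s01 ∷ s02 ∷ s03 ∷ s04 ∷ s12 ∷ s13 ∷ s14 ∷ s23 ∷ s24 ∷ s34 ∷ []) =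
    x0 * x0 * s0 + x1 * x1 * s1 + x2 * x2 * s2 + x3 * x3 * s3 + x4 * x4 * s4 +
      (x0 * x1 * s01 + x0 * x2 * s02 + x0 * x3 * s03 + x0 * x4 * s04 + x1 * x2 * s12 +
       x1 * x3 * s13 + x1 * x4 * s14 + x2 * x3 * s23 + x2 * x4 * s24 + x3 * x4 * s34)

  quadForm-symmetrised : ∀ x G → lin x (λ k → lin x (G k)) ≡ quadForm x (symmetrised G)
  quadForm-symmetrised (x0 ∷ x1 ∷ x2 ∷ x3 ∷ x4 ∷ []) G = law x0 x1 x2 x3 x4
    (G (# 0) (# 0)) (G (# 0) (# 1)) (G (# 0) (# 2)) (G (# 0) (# 3)) (G (# 0) (# 4))
    (G (# 1) (# 0)) (G (# 1) (# 1)) (G (# 1) (# 2)) (G (# 1) (# 3)) (G (# 1) (# 4))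
    (G (# 2) (# 0)) (G (# 2) (# 1)) (G (# 2) (# 2)) (G (# 2) (# 3)) (G (# 2) (# 4))
    (G (# 3) (# 0)) (G (# 3) (# 1)) (G (# 3) (# 2)) (G (# 3) (# 3)) (G (# 3) (# 4))
    (G (# 4) (# 0)) (G (# 4) (# 1)) (G (# 4) (# 2)) (G (# 4) (# 3)) (G (# 4) (# 4))
    where
    law : ∀ x0 x1 x2 x3 x4 h00 h01 h02 h03 h04 h10 h11 h12 h13 h14 h20 h21 h22 h23 h24 h30 h31 h32 h33 h34 h40 h41 h42 h43 h44 →
      x0 * (x0 * h00 + (x1 * h01 + (x2 * h02 + (x3 * h03 + (x4 * h04 + + 0))))) +
      (x1 * (x0 * h10 + (x1 * h11 + (x2 * h12 + (x3 * h13 + (x4 * h14 + + 0))))) +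
      (x2 * (x0 * h20 + (x1 * h21 + (x2 * h22 + (x3 * h23 + (x4 * h24 + + 0))))) +
      (x3 * (x0 * h30 + (x1 * h31 + (x2 * h32 + (x3 * h33 + (x4 * h34 + + 0))))) +
      (x4 * (x0 * h40 + (x1 * h41 + (x2 * h42 + (x3 * h43 + (x4 * h44 + + 0))))) + + 0))))
      ≡ x0 * x0 * h00 + x1 * x1 * h11 + x2 * x2 * h22 + x3 * x3 * h33 + x4 * x4 * h44 +
        (x0 * x1 * (h01 + h10) + x0 * x2 * (h02 + h20) + x0 * x3 * (h03 + h30) + x0 * x4 * (h04 + h40) +
         x1 * x2 * (h12 + h21) + x1 * x3 * (h13 + h31) + x1 * x4 * (h14 + h41) +
         x2 * x3 * (h23 + h32) + x2 * x4 * (h24 + h42) + x3 * x4 * (h34 + h43))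
    law = solve-∀

  -- Within a block the five vectors are orthogonal with norms 8, 8, 8, 8, 12; across blocks only the
  -- symmetrised Gram matrix vanishes, which suffices because both sides use the same coefficients.
  blockGram : Bool → Vec ℤ 15
  blockGram true  = + 8 ∷ + 8 ∷ + 8 ∷ + 8 ∷ + 12 ∷ + 0 ∷ + 0 ∷ + 0 ∷ + 0 ∷ + 0 ∷ + 0 ∷ + 0 ∷ + 0 ∷ + 0 ∷ + 0 ∷ []
  blockGram false = + 0 ∷ + 0 ∷ + 0 ∷ + 0 ∷ + 0 ∷ + 0 ∷ + 0 ∷ + 0 ∷ + 0 ∷ + 0 ∷ + 0 ∷ + 0 ∷ + 0 ∷ + 0 ∷ + 0 ∷ []

  gram-symmetrised : ∀ r r' → symmetrised (λ k l → inner 3 (B r k) (B r' l)) ≡ blockGram (does (r Fin.≟ r'))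
  gram-symmetrised = toWitness {a? = all? λ r → all? λ r' →
    Vec.≡-dec ℤ._≟_ (symmetrised (λ k l → inner 3 (B r k) (B r' l))) (blockGram (does (r Fin.≟ r')))} tt

  blockVector : Vec ℤ 5 → Fin 16 → V 3
  blockVector x r = combo x (B r)

  inner-blockVector : ∀ x r r' → inner 3 (blockVector x r) (blockVector x r') ≡ quadForm x (blockGram (does (r Fin.≟ r')))
  inner-blockVector x r r' = begin
    inner 3 (combo x (B r)) (combo x (B r'))                     ≡⟨ inner-combo 3 x (B r) x (B r') ⟩
    lin x (λ k → lin x (λ l → inner 3 (B r k) (B r' l)))         ≡⟨ quadForm-symmetrised x (λ k l → inner 3 (B r k) (B r' l)) ⟩
    quadForm x (symmetrised (λ k l → inner 3 (B r k) (B r' l)))  ≡⟨ cong (quadForm x) (gram-symmetrised r r') ⟩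
    quadForm x (blockGram (does (r Fin.≟ r')))                   ∎
    where open ≡-Reasoning

  σ : Bool → ℤ
  σ false = + 1
  σ true  = -[1+ 0 ]

  double : Bool → V 3 → V 4
  double s u (false ∷ w) = u w
  double s u (true  ∷ w) = σ s ·ᵍ u w

  -- (u | -u) = (u | u + (1+i)(-1+i) u) is a Plotkin vector because (1+i)(-1+i) = -2.
  InBW-double : ∀ s {u} → InBW 3 u → InBW 4 (double s u)
  InBW-double s {u} Lu = InBW-resp 4 (InBW-plotkin 3 Lu (InBW-scale 3 (c s) Lu)) halves
    where
    c : Bool → ℤ[i]
    c false = 0ᵍ
    c true  = (-[1+ 0 ] , + 1)
    second : ∀ s a → a +ᵍ (1+i *ᵍ (c s *ᵍ a)) ≡ σ s ·ᵍ a
    second false (a1 , a2) = cong₂ _,_ (re-law a1 a2) (im-law a1 a2)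
      where
      re-law : ∀ a1 a2 → a1 + ((+ 1) * ((+ 0) * a1 - (+ 0) * a2) - (+ 1) * ((+ 0) * a2 + (+ 0) * a1)) ≡ (+ 1) * a1
      re-law = solve-∀
      im-law : ∀ a1 a2 → a2 + ((+ 1) * ((+ 0) * a2 + (+ 0) * a1) + (+ 1) * ((+ 0) * a1 - (+ 0) * a2)) ≡ (+ 1) * a2
      im-law = solve-∀
    second true (a1 , a2) = cong₂ _,_ (re-law a1 a2) (im-law a1 a2)
      where
      re-law : ∀ a1 a2 → a1 + ((+ 1) * ((-[1+ 0 ]) * a1 - (+ 1) * a2) - (+ 1) * ((-[1+ 0 ]) * a2 + (+ 1) * a1)) ≡ (-[1+ 0 ]) * a1
      re-law = solve-∀
      im-law : ∀ a1 a2 → a2 + ((+ 1) * ((-[1+ 0 ]) * a2 + (+ 1) * a1) + (+ 1) * ((-[1+ 0 ]) * a1 - (+ 1) * a2)) ≡ (-[1+ 0 ]) * a2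
      im-law = solve-∀
    halves : plotkin u (λ w → c s *ᵍ u w) ≗ double s u
    halves (false ∷ w) = refl
    halves (true  ∷ w) = second s (u w)

  herm-·ᵍ : ∀ k a b (x y : V k) → herm k (λ w → a ·ᵍ x w) (λ w → b ·ᵍ y w) ≡ (a * b) ·ᵍ herm k x y
  herm-·ᵍ k a b x y = trans (∑ᵍ-cong (words k) (λ j → ·̄-·ᵍ (x j) (y j))) (∑ᵍ-· (words k) (a * b) (λ j → x j ·̄ y j))
    where
    ·̄-·ᵍ : ∀ p q → (a ·ᵍ p) ·̄ (b ·ᵍ q) ≡ (a * b) ·ᵍ (p ·̄ q)
    ·̄-·ᵍ (p1 , p2) (q1 , q2) = cong₂ _,_ (re-law a b p1 p2 q1 q2) (im-law a b p1 p2 q1 q2)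
      where
      re-law : ∀ a b p1 p2 q1 q2 → a * p1 * (b * q1) + a * p2 * (b * q2) ≡ a * b * (p1 * q1 + p2 * q2)
      re-law = solve-∀
      im-law : ∀ a b p1 p2 q1 q2 → a * p2 * (b * q1) - a * p1 * (b * q2) ≡ a * b * (p2 * q1 - p1 * q2)
      im-law = solve-∀

  inner-double : ∀ s s' u u' → inner 4 (double s u) (double s' u') ≡ (+ 1 + σ s * σ s') * inner 3 u u'
  inner-double s s' u u' = trans (cong re (herm-suc 3 (double s u) (double s' u')))
    (trans (cong (_+_ (inner 3 u u')) (cong re (herm-·ᵍ 3 (σ s) (σ s') u u'))) (law (σ s * σ s') (inner 3 u u')))
    where
    law : ∀ t i → i + t * i ≡ (+ 1 + t) * i
    law = solve-∀

  frameAt : Vec ℤ 5 → Fin 16 ⊎ Fin 16 → V 4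
  frameAt x (inj₁ r) = double false (blockVector x r)
  frameAt x (inj₂ r) = double true  (blockVector x r)

  frame : Vec ℤ 5 → Fin 32 → V32
  frame x = frameAt x ∘ splitAt 16

  InBW-frameAt : ∀ x p → InBW 4 (frameAt x p)
  InBW-frameAt x (inj₁ r) = InBW-double false (InBW-combo 3 x (InBW-B r))
  InBW-frameAt x (inj₂ r) = InBW-double true  (InBW-combo 3 x (InBW-B r))

  quadForm-0 : ∀ x → quadForm x (blockGram false) ≡ + 0
  quadForm-0 (x0 ∷ x1 ∷ x2 ∷ x3 ∷ x4 ∷ []) = law x0 x1 x2 x3 x4
    where
    law : ∀ x0 x1 x2 x3 x4 →
      x0 * x0 * + 0 + x1 * x1 * + 0 + x2 * x2 * + 0 + x3 * x3 * + 0 + x4 * x4 * + 0 +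
        (x0 * x1 * + 0 + x0 * x2 * + 0 + x0 * x3 * + 0 + x0 * x4 * + 0 + x1 * x2 * + 0 +
         x1 * x3 * + 0 + x1 * x4 * + 0 + x2 * x3 * + 0 + x2 * x4 * + 0 + x3 * x4 * + 0) ≡ + 0
    law = solve-∀

  inner-blockVector-self : ∀ x r → inner 3 (blockVector x r) (blockVector x r) ≡ quadForm x (blockGram true)
  inner-blockVector-self x r = trans (inner-blockVector x r r) (cong (quadForm x ∘ blockGram) (dec-true (r Fin.≟ r) refl))

  inner-blockVector-distinct : ∀ x r r' → r ≢ r' → inner 3 (blockVector x r) (blockVector x r') ≡ + 0
  inner-blockVector-distinct x r r' r≢r' = trans (inner-blockVector x r r')
    (trans (cong (quadForm x ∘ blockGram) (dec-false (r Fin.≟ r') r≢r')) (quadForm-0 x))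

  frameAt-norm : ∀ x p → inner 4 (frameAt x p) (frameAt x p) ≡ + 2 * quadForm x (blockGram true)
  frameAt-norm x (inj₁ r) = trans (inner-double false false (blockVector x r) (blockVector x r)) (cong (+ 2 *_) (inner-blockVector-self x r))
  frameAt-norm x (inj₂ r) = trans (inner-double true  true  (blockVector x r) (blockVector x r)) (cong (+ 2 *_) (inner-blockVector-self x r))

  frameAt-orthogonal : ∀ x p q → p ≢ q → inner 4 (frameAt x p) (frameAt x q) ≡ + 0
  frameAt-orthogonal x (inj₁ r) (inj₁ r') p≢q =
    trans (inner-double false false (blockVector x r) (blockVector x r')) (cong (+ 2 *_) (inner-blockVector-distinct x r r' (p≢q ∘ cong inj₁)))
  frameAt-orthogonal x (inj₂ r) (inj₂ r') p≢q =
    trans (inner-double true true (blockVector x r) (blockVector x r')) (cong (+ 2 *_) (inner-blockVector-distinct x r r' (p≢q ∘ cong inj₂)))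
  frameAt-orthogonal x (inj₁ r) (inj₂ r') _ = trans (inner-double false true (blockVector x r) (blockVector x r')) (ℤ.*-zeroˡ (inner 3 (blockVector x r) (blockVector x r')))
  frameAt-orthogonal x (inj₂ r) (inj₁ r') _ = trans (inner-double true false (blockVector x r) (blockVector x r')) (ℤ.*-zeroˡ (inner 3 (blockVector x r) (blockVector x r')))

  splitAt-injective : ∀ m {n} {i j : Fin (m ℕ.+ n)} → splitAt m i ≡ splitAt m j → i ≡ j
  splitAt-injective m {n} {i} {j} e = trans (sym (Fin.join-splitAt m n i)) (trans (cong (join m n) e) (Fin.join-splitAt m n j))

  frame-isFrame : ∀ m x → + 2 * quadForm x (blockGram true) ≡ + (4 ℕ.* m) → IsFrame m (frame x)
  frame-isFrame m x 2Q≡4m =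
    (λ i → InBW-frameAt x (splitAt 16 i)) ,
    (λ { i .i refl → trans (inner4≡inner (frame x i) (frame x i)) (trans (frameAt-norm x (splitAt 16 i)) 2Q≡4m) }) ,
    λ i j i≢j → trans (inner4≡inner (frame x i) (frame x j))
                      (frameAt-orthogonal x (splitAt 16 i) (splitAt 16 j) (i≢j ∘ splitAt-injective 16))

  -- Lagrange's four-square theorem

  fourSquareSum : ℤ → ℤ → ℤ → ℤ → ℤ
  fourSquareSum a b c d = a * a + b * b + c * c + d * d

  FourSquares : ℤ → Set
  FourSquares n = ∃ λ a → ∃ λ b → ∃ λ c → ∃ λ d → n ≡ fourSquareSum a b c d

  fourSquareSum-cong : ∀ {a b c d a' b' c' d'} → a ≡ a' → b ≡ b' → c ≡ c' → d ≡ d' →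
    fourSquareSum a b c d ≡ fourSquareSum a' b' c' d'
  fourSquareSum-cong refl refl refl refl = refl

  fourSquareSum-nonneg : ∀ a b c d → + 0 ≤ fourSquareSum a b c d
  fourSquareSum-nonneg a b c d =
    ℤ.+-mono-≤ (ℤ.+-mono-≤ (ℤ.+-mono-≤ (square-nonneg a) (square-nonneg b)) (square-nonneg c)) (square-nonneg d)

  fourSquareSum≡0 : ∀ a b c d → fourSquareSum a b c d ≡ + 0 → a ≡ + 0 × b ≡ + 0 × c ≡ + 0 × d ≡ + 0
  fourSquareSum≡0 a b c d abcd≡0
    with abc≡0 , d≡0 ← nonneg-sum≡0 (ℤ.+-mono-≤ (ℤ.+-mono-≤ (square-nonneg a) (square-nonneg b)) (square-nonneg c))
                                    (square-nonneg d) abcd≡0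
    with ab≡0 , c≡0 ← nonneg-sum≡0 (ℤ.+-mono-≤ (square-nonneg a) (square-nonneg b)) (square-nonneg c) abc≡0
    with a≡0 , b≡0 ← nonneg-sum≡0 (square-nonneg a) (square-nonneg b) ab≡0
    = square≡0 a a≡0 , square≡0 b b≡0 , square≡0 c c≡0 , square≡0 d d≡0

  FourSquares-* : ∀ {x y} → FourSquares x → FourSquares y → FourSquares (x * y)
  FourSquares-* (a1 , a2 , a3 , a4 , refl) (b1 , b2 , b3 , b4 , refl) =
    (a1 * b1 + a2 * b2 + a3 * b3 + a4 * b4) , (a1 * b2 - a2 * b1 + a3 * b4 - a4 * b3) ,
    (a1 * b3 - a3 * b1 + a4 * b2 - a2 * b4) , (a1 * b4 - a4 * b1 + a2 * b3 - a3 * b2) , euler a1 a2 a3 a4 b1 b2 b3 b4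
    where
    euler : ∀ a1 a2 a3 a4 b1 b2 b3 b4 →
      (a1 * a1 + a2 * a2 + a3 * a3 + a4 * a4) * (b1 * b1 + b2 * b2 + b3 * b3 + b4 * b4) ≡
      (a1 * b1 + a2 * b2 + a3 * b3 + a4 * b4) * (a1 * b1 + a2 * b2 + a3 * b3 + a4 * b4) +
      (a1 * b2 - a2 * b1 + a3 * b4 - a4 * b3) * (a1 * b2 - a2 * b1 + a3 * b4 - a4 * b3) +
      (a1 * b3 - a3 * b1 + a4 * b2 - a2 * b4) * (a1 * b3 - a3 * b1 + a4 * b2 - a2 * b4) +
      (a1 * b4 - a4 * b1 + a2 * b3 - a3 * b2) * (a1 * b4 - a4 * b1 + a2 * b3 - a3 * b2)
    euler = solve-∀

  prime⇒no-proper-divisor : ∀ {p} → Prime p → ∀ m → 2 ℕ.≤ m → m ℕ.< p → m ∣ p → ⊥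
  prime⇒no-proper-divisor (prime nc) (suc (suc m)) _ m<p m∣p = nc (hasNonTrivialDivisor m<p m∣p)
  prime⇒no-proper-divisor _ (suc zero) (s≤s ())

  parity : ∀ m → (∃ λ h → m ≡ h ℕ.+ h) ⊎ (∃ λ h → m ≡ suc (h ℕ.+ h))
  parity zero = inj₁ (0 , refl)
  parity (suc m) with parity m
  ... | inj₁ (h , e) = inj₂ (h , cong suc e)
  ... | inj₂ (h , e) = inj₁ (suc h , trans (cong suc e) (cong suc (sym (ℕ.+-suc h h))))

  centred-residue : ∀ (x : ℤ) h → ∃₂ λ y q → x ≡ y + q * + suc (h ℕ.+ h) × y * y ≤ + h * + h
  centred-residue x h = + t - + h , q , shift (ℤ/.a≡a%ℕn+[a/ℕn]*n (x + + h) m) , bound (ℕ.≤-pred (ℤ/.n%ℕd<d (x + + h) m))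
    where
    m = suc (h ℕ.+ h)
    t = (x + + h) %ℕ m
    q = (x + + h) /ℕ m
    shift : x + + h ≡ + t + q * + m → x ≡ (+ t - + h) + q * + m
    shift e = trans (l1 x (+ h)) (trans (cong (_- + h) e) (l2 (+ t) (+ h) q (+ m)))
      where
      l1 : ∀ x h → x ≡ (x + h) - h
      l1 = solve-∀
      l2 : ∀ t h q M → (t + q * M) - h ≡ (t - h) + q * M
      l2 = solve-∀
    -- (t - h)² = h² - t (2h - t) with 0 ≤ t ≤ 2h.
    bound : t ℕ.≤ h ℕ.+ h → (+ t - + h) * (+ t - + h) ≤ + h * + h
    bound t≤2h = ℤ.≤-trans (ℤ.≤-reflexive (trans (law (+ t) (+ h)) (cong (λ z → + h * + h - z) (trans (cong (+ t *_) 2h-t≡s) (sym (ℤ.pos-* t s))))))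
                           (ℤ.i-j≤i (+ h * + h) (+ (t ℕ.* s)))
      where
      s = (h ℕ.+ h) ℕ.∸ t
      law : ∀ T H → (T - H) * (T - H) ≡ H * H - T * ((H + H) - T)
      law = solve-∀
      cancel : ∀ T S → S ≡ (T + S) - T
      cancel = solve-∀
      2h-t≡s : (+ h + + h) - + t ≡ + s
      2h-t≡s = trans (cong (_- + t) (trans (sym (ℤ.pos-+ h h)) (trans (cong +_ (sym (ℕ.m+[n∸m]≡n t≤2h))) (ℤ.pos-+ t s))))
                     (sym (cancel (+ t) (+ s)))

  -- Lagrange's descent step for odd m = 2h + 1: reduce every xᵢ to a centred residue yᵢ modulo m;
  -- then m r = Σ yᵢ² < m² and Euler's identity exhibits r p as a sum of four squares.
  descent-odd : ∀ {p} → Prime p → ∀ h → 1 ℕ.≤ h → suc (h ℕ.+ h) ℕ.< p → FourSquares (+ suc (h ℕ.+ h) * + p) →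
    ∃ λ r → 1 ℕ.≤ r × r ℕ.< suc (h ℕ.+ h) × FourSquares (+ r * + p)
  descent-odd {p} pp h 1≤h m<p (a1 , a2 , a3 , a4 , mp≡)
    with y1 , q1 , refl , b1 ← centred-residue a1 h
    with y2 , q2 , refl , b2 ← centred-residue a2 h
    with y3 , q3 , refl , b3 ← centred-residue a3 h
    with y4 , q4 , refl , b4 ← centred-residue a4 h
    = positive r Mr≡ rp≡ r<M
    where
    m = suc (h ℕ.+ h)
    M = + m
    Hℤ = + h
    x1 = y1 + q1 * M
    x2 = y2 + q2 * M
    x3 = y3 + q3 * M
    x4 = y4 + q4 * M
    E = x1 * q1 + x2 * q2 + x3 * q3 + x4 * q4
    Q = fourSquareSum q1 q2 q3 q4
    r : ℤ
    r = + p - + 2 * E + M * Q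
    Mr≡ : M * r ≡ fourSquareSum y1 y2 y3 y4
    Mr≡ = trans (expand M (+ p) E Q) (trans (cong (λ a → a - (+ 2 * M * E - M * M * Q)) mp≡) (reduce M y1 y2 y3 y4 q1 q2 q3 q4))
      where
      expand : ∀ M P S Q → M * (P - + 2 * S + M * Q) ≡ M * P - (+ 2 * M * S - M * M * Q)
      expand = solve-∀
      reduce : ∀ M y1 y2 y3 y4 q1 q2 q3 q4 →
        ((y1 + q1 * M) * (y1 + q1 * M) + (y2 + q2 * M) * (y2 + q2 * M) + (y3 + q3 * M) * (y3 + q3 * M) + (y4 + q4 * M) * (y4 + q4 * M)) -
          (+ 2 * M * ((y1 + q1 * M) * q1 + (y2 + q2 * M) * q2 + (y3 + q3 * M) * q3 + (y4 + q4 * M) * q4) - M * M * (q1 * q1 + q2 * q2 + q3 * q3 + q4 * q4))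
        ≡ (y1 * y1 + y2 * y2 + y3 * y3 + y4 * y4)
      reduce = solve-∀
    w1 = + p - E
    w2 = - (x1 * q2 - x2 * q1 + x3 * q4 - x4 * q3)
    w3 = - (x1 * q3 - x3 * q1 + x4 * q2 - x2 * q4)
    w4 = - (x1 * q4 - x4 * q1 + x2 * q3 - x3 * q2)
    rp≡ : fourSquareSum w1 w2 w3 w4 ≡ r * + p
    rp≡ = trans (euler (+ p) x1 x2 x3 x4 q1 q2 q3 q4)
          (trans (cong (λ z → + p * + p - + 2 * + p * E + z * Q) (sym mp≡)) (factor (+ p) M E Q))
      where
      euler : ∀ P x1 x2 x3 x4 q1 q2 q3 q4 →
        ((P - (x1 * q1 + x2 * q2 + x3 * q3 + x4 * q4)) * (P - (x1 * q1 + x2 * q2 + x3 * q3 + x4 * q4)) +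
         (- (x1 * q2 - x2 * q1 + x3 * q4 - x4 * q3)) * (- (x1 * q2 - x2 * q1 + x3 * q4 - x4 * q3)) +
         (- (x1 * q3 - x3 * q1 + x4 * q2 - x2 * q4)) * (- (x1 * q3 - x3 * q1 + x4 * q2 - x2 * q4)) +
         (- (x1 * q4 - x4 * q1 + x2 * q3 - x3 * q2)) * (- (x1 * q4 - x4 * q1 + x2 * q3 - x3 * q2)))
        ≡ P * P - + 2 * P * (x1 * q1 + x2 * q2 + x3 * q3 + x4 * q4) +
          (x1 * x1 + x2 * x2 + x3 * x3 + x4 * x4) * (q1 * q1 + q2 * q2 + q3 * q3 + q4 * q4)
      euler = solve-∀
      factor : ∀ P M E Q → P * P - + 2 * P * E + (M * P) * Q ≡ (P - + 2 * E + M * Q) * P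
      factor = solve-∀
    r<M : r < M
    r<M = ℤ.*-cancelˡ-<-nonNeg M (begin-strict
      M * r                                ≡⟨ Mr≡ ⟩
      fourSquareSum y1 y2 y3 y4            ≤⟨ ℤ.+-mono-≤ (ℤ.+-mono-≤ (ℤ.+-mono-≤ b1 b2) b3) b4 ⟩
      Hℤ * Hℤ + Hℤ * Hℤ + Hℤ * Hℤ + Hℤ * Hℤ         ≡⟨ ℤ.+-identityʳ _ ⟨
      Hℤ * Hℤ + Hℤ * Hℤ + Hℤ * Hℤ + Hℤ * Hℤ + + 0   <⟨ ℤ.+-monoʳ-< (Hℤ * Hℤ + Hℤ * Hℤ + Hℤ * Hℤ + Hℤ * Hℤ) 0<1+4h ⟩
      Hℤ * Hℤ + Hℤ * Hℤ + Hℤ * Hℤ + Hℤ * Hℤ + (+ 1 + + 4 * Hℤ) ≡⟨ square Hℤ ⟨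
      (+ 1 + (Hℤ + Hℤ)) * (+ 1 + (Hℤ + Hℤ))     ≡⟨ cong₂ _*_ M≡ M≡ ⟨
      M * M                                ∎)
      where
      open ℤ.≤-Reasoning
      square : ∀ t → (+ 1 + (t + t)) * (+ 1 + (t + t)) ≡ t * t + t * t + t * t + t * t + (+ 1 + + 4 * t)
      square = solve-∀
      M≡ : M ≡ + 1 + (Hℤ + Hℤ)
      M≡ = trans (ℤ.pos-+ 1 (h ℕ.+ h)) (cong (_+_ (+ 1)) (ℤ.pos-+ h h))
      0<1+4h : + 0 < + 1 + + 4 * Hℤ
      0<1+4h = subst (+ 0 <_) (trans (ℤ.pos-+ 1 (4 ℕ.* h)) (cong (_+_ (+ 1)) (ℤ.pos-* 4 h))) (+<+ (s≤s z≤n))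
    positive : ∀ r → M * r ≡ fourSquareSum y1 y2 y3 y4 → fourSquareSum w1 w2 w3 w4 ≡ r * + p → r < M →
      ∃ λ r → 1 ℕ.≤ r × r ℕ.< m × FourSquares (+ r * + p)
    positive (+ suc r') _ rp≡' r<M' = suc r' , s≤s z≤n , ℤ.drop‿+<+ r<M' , w1 , w2 , w3 , w4 , sym rp≡'
    positive -[1+ n ] Mr≡' _ _ with () ← ℤ.≤-trans (fourSquareSum-nonneg y1 y2 y3 y4) (ℤ.≤-reflexive (sym Mr≡'))
    positive (+ zero) Mr≡' _ _ =
      ⊥-elim (prime⇒no-proper-divisor pp m (s≤s (ℕ.≤-trans 1≤h (ℕ.m≤m+n h h))) m<p (divides ∣ Q ∣ p≡m∣Q∣))
      where
      y≡0 = fourSquareSum≡0 y1 y2 y3 y4 (trans (sym Mr≡') (ℤ.*-zeroʳ M))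
      p≡MQ : + p ≡ M * Q
      p≡MQ = ℤ.*-cancelˡ-≡ M (+ p) (M * Q) (begin
        M * + p                                       ≡⟨ mp≡ ⟩
        fourSquareSum x1 x2 x3 x4                     ≡⟨ fourSquareSum-cong (drop q1 (proj₁ y≡0)) (drop q2 (proj₁ (proj₂ y≡0)))
                                                           (drop q3 (proj₁ (proj₂ (proj₂ y≡0)))) (drop q4 (proj₂ (proj₂ (proj₂ y≡0)))) ⟩
        fourSquareSum (q1 * M) (q2 * M) (q3 * M) (q4 * M) ≡⟨ law M q1 q2 q3 q4 ⟩
        M * (M * Q)                                   ∎)
        where
        open ≡-Reasoning
        drop : ∀ {y} q → y ≡ + 0 → y + q * M ≡ q * M
        drop q refl = ℤ.+-identityˡ (q * M)
        law : ∀ M q1 q2 q3 q4 → (q1 * M) * (q1 * M) + (q2 * M) * (q2 * M) + (q3 * M) * (q3 * M) + (q4 * M) * (q4 * M) ≡ M * (M * (q1 * q1 + q2 * q2 + q3 * q3 + q4 * q4))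
        law = solve-∀
      p≡m∣Q∣ : p ≡ ∣ Q ∣ ℕ.* m
      p≡m∣Q∣ = ℤ.+-injective (trans p≡MQ (trans (cong (M *_) (sym (ℤ.0≤i⇒+∣i∣≡i (fourSquareSum-nonneg q1 q2 q3 q4))))
                 (trans (sym (ℤ.pos-* m ∣ Q ∣)) (cong +_ (ℕ.*-comm m ∣ Q ∣)))))

  2*≢2*+1 : ∀ a b → + 2 * a ≢ + 2 * b + + 1
  2*≢2*+1 a b e = 2*≢1 (a - b) (trans (l a b) (trans (cong (λ z → z - + 2 * b) e) (l2 b)))
    where
    l : ∀ a b → + 2 * (a - b) ≡ + 2 * a - + 2 * b
    l = solve-∀
    l2 : ∀ b → + 2 * b + + 1 - + 2 * b ≡ + 1
    l2 = solve-∀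
    2*≢1 : ∀ c → + 2 * c ≢ + 1
    2*≢1 (+ suc n) e with () ← trans (sym (ℕ.+-suc n (n ℕ.+ 0))) (cong ℕ.pred (ℤ.+-injective (trans (ℤ.pos-* 2 (suc n)) e)))

  odd-parities-impossible : ∀ T a1 a2 a3 a4 E1 E2 E3 E4 K →
    + 2 * T ≡ fourSquareSum (E1 + a1 * + 2) (E2 + a2 * + 2) (E3 + a3 * + 2) (E4 + a4 * + 2) →
    E1 * E1 + E2 * E2 + E3 * E3 + E4 * E4 ≡ + 2 * K + + 1 → ⊥
  odd-parities-impossible T a1 a2 a3 a4 E1 E2 E3 E4 K 2T≡ odd =
    2*≢2*+1 T (S + K) (trans 2T≡ (trans (expand a1 a2 a3 a4 E1 E2 E3 E4) (trans (cong (_+_ (+ 2 * S)) odd) (regroup S K))))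
    where
    S = + 2 * (a1 * a1 + a2 * a2 + a3 * a3 + a4 * a4) + + 2 * (a1 * E1 + a2 * E2 + a3 * E3 + a4 * E4)
    expand : ∀ a b c d E1 E2 E3 E4 →
      ((E1 + a * + 2) * (E1 + a * + 2) + (E2 + b * + 2) * (E2 + b * + 2) + (E3 + c * + 2) * (E3 + c * + 2) + (E4 + d * + 2) * (E4 + d * + 2))
      ≡ + 2 * (+ 2 * (a * a + b * b + c * c + d * d) + + 2 * (a * E1 + b * E2 + c * E3 + d * E4)) + (E1 * E1 + E2 * E2 + E3 * E3 + E4 * E4)
    expand = solve-∀
    regroup : ∀ S K → + 2 * S + (+ 2 * K + + 1) ≡ + 2 * (S + K) + + 1
    regroup = solve-∀

  halve-pairs : ∀ T a b c d E F → + 2 * T ≡ fourSquareSum (E + a * + 2) (E + b * + 2) (F + c * + 2) (F + d * + 2) → FourSquares T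
  halve-pairs T a b c d E F 2T≡ =
    (a + b + E) , (a - b) , (c + d + F) , (c - d) , ℤ.*-cancelˡ-≡ (+ 2) T _ (trans 2T≡ (law a b c d E F))
    where
    law : ∀ a b c d E F →
      ((E + a * + 2) * (E + a * + 2) + (E + b * + 2) * (E + b * + 2) + (F + c * + 2) * (F + c * + 2) + (F + d * + 2) * (F + d * + 2))
      ≡ + 2 * ((a + b + E) * (a + b + E) + (a - b) * (a - b) + (c + d + F) * (c + d + F) + (c - d) * (c - d))
    law = solve-∀

  halve-pairs₁₃ : ∀ T a1 a2 a3 a4 E F → + 2 * T ≡ fourSquareSum (E + a1 * + 2) (F + a2 * + 2) (E + a3 * + 2) (F + a4 * + 2) →
    FourSquares T
  halve-pairs₁₃ T a1 a2 a3 a4 E F e = halve-pairs T a1 a3 a2 a4 E F (trans e (swap (E + a1 * + 2) (F + a2 * + 2) (E + a3 * + 2) (F + a4 * + 2)))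
    where
    swap : ∀ x1 x2 x3 x4 → x1 * x1 + x2 * x2 + x3 * x3 + x4 * x4 ≡ x1 * x1 + x3 * x3 + x2 * x2 + x4 * x4
    swap = solve-∀

  halve-pairs₁₄ : ∀ T a1 a2 a3 a4 E F → + 2 * T ≡ fourSquareSum (E + a1 * + 2) (F + a2 * + 2) (F + a3 * + 2) (E + a4 * + 2) →
    FourSquares T
  halve-pairs₁₄ T a1 a2 a3 a4 E F e = halve-pairs T a1 a4 a2 a3 E F (trans e (swap (E + a1 * + 2) (F + a2 * + 2) (F + a3 * + 2) (E + a4 * + 2)))
    where
    swap : ∀ x1 x2 x3 x4 → x1 * x1 + x2 * x2 + x3 * x3 + x4 * x4 ≡ x1 * x1 + x4 * x4 + x2 * x2 + x3 * x3
    swap = solve-∀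

  -- Either the parities can be paired off, or an odd number of them is odd.
  halve-by-parity : ∀ T (a1 a2 a3 a4 : ℤ) (e1 e2 e3 e4 : ℕ) → e1 ℕ.< 2 → e2 ℕ.< 2 → e3 ℕ.< 2 → e4 ℕ.< 2 →
    + 2 * T ≡ fourSquareSum (+ e1 + a1 * + 2) (+ e2 + a2 * + 2) (+ e3 + a3 * + 2) (+ e4 + a4 * + 2) → FourSquares T
  halve-by-parity T a1 a2 a3 a4 (suc (suc _)) _ _ _ (s≤s (s≤s ())) _ _ _ _
  halve-by-parity T a1 a2 a3 a4 _ (suc (suc _)) _ _ _ (s≤s (s≤s ())) _ _ _
  halve-by-parity T a1 a2 a3 a4 _ _ (suc (suc _)) _ _ _ (s≤s (s≤s ())) _ _
  halve-by-parity T a1 a2 a3 a4 _ _ _ (suc (suc _)) _ _ _ (s≤s (s≤s ())) _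
  halve-by-parity T a1 a2 a3 a4 0 0 0 0 _ _ _ _ e = halve-pairs T a1 a2 a3 a4 (+ 0) (+ 0) e
  halve-by-parity T a1 a2 a3 a4 0 0 0 1 _ _ _ _ e = ⊥-elim (odd-parities-impossible T a1 a2 a3 a4 (+ 0) (+ 0) (+ 0) (+ 1) (+ 0) e refl)
  halve-by-parity T a1 a2 a3 a4 0 0 1 0 _ _ _ _ e = ⊥-elim (odd-parities-impossible T a1 a2 a3 a4 (+ 0) (+ 0) (+ 1) (+ 0) (+ 0) e refl)
  halve-by-parity T a1 a2 a3 a4 0 0 1 1 _ _ _ _ e = halve-pairs T a1 a2 a3 a4 (+ 0) (+ 1) e
  halve-by-parity T a1 a2 a3 a4 0 1 0 0 _ _ _ _ e = ⊥-elim (odd-parities-impossible T a1 a2 a3 a4 (+ 0) (+ 1) (+ 0) (+ 0) (+ 0) e refl)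
  halve-by-parity T a1 a2 a3 a4 0 1 0 1 _ _ _ _ e = halve-pairs₁₃ T a1 a2 a3 a4 (+ 0) (+ 1) e
  halve-by-parity T a1 a2 a3 a4 0 1 1 0 _ _ _ _ e = halve-pairs₁₄ T a1 a2 a3 a4 (+ 0) (+ 1) e
  halve-by-parity T a1 a2 a3 a4 0 1 1 1 _ _ _ _ e = ⊥-elim (odd-parities-impossible T a1 a2 a3 a4 (+ 0) (+ 1) (+ 1) (+ 1) (+ 1) e refl)
  halve-by-parity T a1 a2 a3 a4 1 0 0 0 _ _ _ _ e = ⊥-elim (odd-parities-impossible T a1 a2 a3 a4 (+ 1) (+ 0) (+ 0) (+ 0) (+ 0) e refl)
  halve-by-parity T a1 a2 a3 a4 1 0 0 1 _ _ _ _ e = halve-pairs₁₄ T a1 a2 a3 a4 (+ 1) (+ 0) e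
  halve-by-parity T a1 a2 a3 a4 1 0 1 0 _ _ _ _ e = halve-pairs₁₃ T a1 a2 a3 a4 (+ 1) (+ 0) e
  halve-by-parity T a1 a2 a3 a4 1 0 1 1 _ _ _ _ e = ⊥-elim (odd-parities-impossible T a1 a2 a3 a4 (+ 1) (+ 0) (+ 1) (+ 1) (+ 1) e refl)
  halve-by-parity T a1 a2 a3 a4 1 1 0 0 _ _ _ _ e = halve-pairs T a1 a2 a3 a4 (+ 1) (+ 0) e
  halve-by-parity T a1 a2 a3 a4 1 1 0 1 _ _ _ _ e = ⊥-elim (odd-parities-impossible T a1 a2 a3 a4 (+ 1) (+ 1) (+ 0) (+ 1) (+ 1) e refl)
  halve-by-parity T a1 a2 a3 a4 1 1 1 0 _ _ _ _ e = ⊥-elim (odd-parities-impossible T a1 a2 a3 a4 (+ 1) (+ 1) (+ 1) (+ 0) (+ 1) e refl)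
  halve-by-parity T a1 a2 a3 a4 1 1 1 1 _ _ _ _ e = halve-pairs T a1 a2 a3 a4 (+ 1) (+ 1) e

  descent-even : ∀ p h → FourSquares (+ (h ℕ.+ h) * + p) → FourSquares (+ h * + p)
  descent-even p h (x1 , x2 , x3 , x4 , e) =
    halve-by-parity (+ h * + p) (x1 /ℕ 2) (x2 /ℕ 2) (x3 /ℕ 2) (x4 /ℕ 2) (x1 %ℕ 2) (x2 %ℕ 2) (x3 %ℕ 2) (x4 %ℕ 2)
      (ℤ/.n%ℕd<d x1 2) (ℤ/.n%ℕd<d x2 2) (ℤ/.n%ℕd<d x3 2) (ℤ/.n%ℕd<d x4 2)
      (trans (twice (+ h) (+ p)) (trans (cong (_* + p) (sym (ℤ.pos-+ h h))) (trans e
        (fourSquareSum-cong (ℤ/.a≡a%ℕn+[a/ℕn]*n x1 2) (ℤ/.a≡a%ℕn+[a/ℕn]*n x2 2) (ℤ/.a≡a%ℕn+[a/ℕn]*n x3 2) (ℤ/.a≡a%ℕn+[a/ℕn]*n x4 2)))))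
    where
    twice : ∀ H P → + 2 * (H * P) ≡ (H + H) * P
    twice = solve-∀

  descent : ∀ {p} → Prime p → ∀ m → 1 ℕ.≤ m → m ℕ.< p → FourSquares (+ m * + p) → FourSquares (+ p)
  descent {p} pp = <-rec (λ m → 1 ℕ.≤ m → m ℕ.< p → FourSquares (+ m * + p) → FourSquares (+ p)) step
    where
    step : ∀ m → (∀ {k} → k ℕ.< m → 1 ℕ.≤ k → k ℕ.< p → FourSquares (+ k * + p) → FourSquares (+ p)) →
      1 ℕ.≤ m → m ℕ.< p → FourSquares (+ m * + p) → FourSquares (+ p)
    step 1 _ _ _ fs = subst FourSquares (ℤ.*-identityˡ (+ p)) fs
    step (suc (suc k)) rec _ m<p fs with parity (suc (suc k))
    ... | inj₁ (suc h , e) = rec h<m (s≤s z≤n) (ℕ.<-trans h<m m<p) (descent-even p (suc h) (subst (λ z → FourSquares (+ z * + p)) e fs))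
      where
      h<m : suc h ℕ.< suc (suc k)
      h<m = subst (suc h ℕ.<_) (sym e) (s≤s (ℕ.m≤n+m (suc h) h))
    ... | inj₂ (suc h , e)
      with r , 1≤r , r<m , fs' ← descent-odd pp (suc h) (s≤s z≤n) (subst (ℕ._< p) e m<p) (subst (λ z → FourSquares (+ z * + p)) e fs)
      = rec (subst (r ℕ.<_) (sym e) r<m) 1≤r (ℕ.<-trans (subst (r ℕ.<_) (sym e) r<m) m<p) fs'

  squares-distinct-mod-p : ∀ {p} → Prime p → ∀ h → p ≡ suc (h ℕ.+ h) → ∀ {a a'} → a ℕ.< a' → a' ℕ.≤ h →
    ∀ k → + a' * + a' - + a * + a ≢ k * + p
  squares-distinct-mod-p {p} pp h refl {a} {a'} a<a' a'≤h k e = p∤DS k DS≡kp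
    where
    D = a' ℕ.∸ a
    S = a ℕ.+ a'
    a'≡a+D : + a' ≡ + a + + D
    a'≡a+D = trans (sym (cong +_ (ℕ.m+[n∸m]≡n (ℕ.<⇒≤ a<a')))) (ℤ.pos-+ a D)
    DS≡kp : + (D ℕ.* S) ≡ k * + p
    DS≡kp = trans (ℤ.pos-* D S) (trans (cong (+ D *_) (ℤ.pos-+ a a'))
      (trans (cong (λ z → + D * (+ a + z)) a'≡a+D) (trans (sym (diff-squares (+ a) (+ D)))
      (trans (cong (λ z → z * z - + a * + a) (sym a'≡a+D)) e))))
      where
      diff-squares : ∀ A D → (A + D) * (A + D) - A * A ≡ D * (A + (A + D))
      diff-squares = solve-∀
    p∤ : ∀ {n} → 0 ℕ.< n → n ℕ.< p → ¬ (p ∣ n)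
    p∤ {n} n>0 n<p p∣n = ℕ.<-irrefl refl (ℕ.<-≤-trans n<p (∣⇒≤ {{ℕ.>-nonZero n>0}} p∣n))
    p∤DS : ∀ k → + (D ℕ.* S) ≢ k * + p
    p∤DS (+ k) DS≡ with euclidsLemma D S pp (divides k (ℤ.+-injective (trans DS≡ (sym (ℤ.pos-* k p)))))
    ... | inj₁ p∣D = p∤ (ℕ.m<n⇒0<n∸m a<a') (ℕ.≤-<-trans (ℕ.m∸n≤m a' a) (ℕ.≤-<-trans a'≤h (s≤s (ℕ.m≤m+n h h)))) p∣D
    ... | inj₂ p∣S = p∤ (ℕ.<-≤-trans (ℕ.≤-<-trans z≤n a<a') (ℕ.m≤n+m a' a))
                        (s≤s (ℕ.+-mono-≤ (ℕ.≤-trans (ℕ.<⇒≤ a<a') a'≤h) a'≤h)) p∣S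

  squares-incongruent : ∀ {p} → Prime p → ∀ h → p ≡ suc (h ℕ.+ h) → ∀ {a a'} → a ≢ a' → a ℕ.≤ h → a' ℕ.≤ h →
    ∀ k → + a * + a - + a' * + a' ≢ k * + p
  squares-incongruent pp h p≡ {a} {a'} a≢a' a≤h a'≤h k e with ℕ.<-cmp a a'
  ... | tri< a<a' _ _ = squares-distinct-mod-p pp h p≡ a<a' a'≤h (- k)
    (trans (trans (negate (+ a * + a) (+ a' * + a')) (cong -_ e)) (neg-* k (+ _)))
    where
    negate : ∀ X Y → Y - X ≡ - (X - Y)
    negate = solve-∀
    neg-* : ∀ k P → - (k * P) ≡ (- k) * P
    neg-* = solve-∀
  ... | tri≈ _ a≡a' _ = a≢a' a≡a'
  ... | tri> _ _ a'<a = squares-distinct-mod-p pp h p≡ a'<a a≤h k e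

  -- Pigeonhole: the h + 1 values a² and the h + 1 values -1 - b² (0 ≤ a, b ≤ h) cannot be
  -- pairwise incongruent modulo p = 2h + 1, and two values of the same kind never are congruent.
  minus-one-sum-of-two-squares : ∀ {p} → Prime p → ∀ h → p ≡ suc (h ℕ.+ h) →
    ∃₂ λ x y → x ℕ.≤ h × y ℕ.≤ h × ∃ λ M → + x * + x + + y * + y + + 1 ≡ M * + p
  minus-one-sum-of-two-squares {p} pp h refl =
    collision (splitAt (suc h) i) (splitAt (suc h) j) (λ e → Fin.<-irrefl (splitAt-injective (suc h) e) i<j) same
    where
    P = suc (h ℕ.+ h)
    square minusOneMinusSquare : ℕ → ℤ
    square a = + a * + a
    minusOneMinusSquare b = -[1+ 0 ] - + b * + b
    value : Fin (suc h) ⊎ Fin (suc h) → ℤ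
    value (inj₁ a) = square (toℕ a)
    value (inj₂ b) = minusOneMinusSquare (toℕ b)
    residue : ℤ → Fin P
    residue z = fromℕ< (ℤ/.n%ℕd<d z P)
    P<N : P ℕ.< suc h ℕ.+ suc h
    P<N = s≤s (ℕ.+-monoʳ-< h (ℕ.n<1+n h))
    pigeon = Fin.pigeonhole P<N (λ i → residue (value (splitAt (suc h) i)))
    i = proj₁ pigeon
    j = proj₁ (proj₂ pigeon)
    i<j = proj₁ (proj₂ (proj₂ pigeon))
    same = proj₂ (proj₂ (proj₂ pigeon))
    quotient : ℤ → ℤ → ℤ
    quotient z z' = z /ℕ P - z' /ℕ P
    congruent : ∀ z z' → residue z ≡ residue z' → z - z' ≡ quotient z z' * + P
    congruent z z' e = trans (cong₂ _-_ (ℤ/.a≡a%ℕn+[a/ℕn]*n z P) (trans (ℤ/.a≡a%ℕn+[a/ℕn]*n z' P) (cong (λ t → + t + (z' /ℕ P) * + P) r≡r')))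
                             (law (+ (z %ℕ P)) (z /ℕ P) (z' /ℕ P) (+ P))
      where
      r≡r' : z' %ℕ P ≡ z %ℕ P
      r≡r' = sym (trans (sym (Fin.toℕ-fromℕ< (ℤ/.n%ℕd<d z P))) (trans (cong toℕ e) (Fin.toℕ-fromℕ< (ℤ/.n%ℕd<d z' P))))
      law : ∀ r q q' P → (r + q * P) - (r + q' * P) ≡ (q - q') * P
      law = solve-∀
    ≤h : (a : Fin (suc h)) → toℕ a ℕ.≤ h
    ≤h a = ℕ.≤-pred (Fin.toℕ<n a)
    toℕ-≢ : ∀ {a a' : Fin (suc h)} → a ≢ a' → toℕ a ≢ toℕ a'
    toℕ-≢ a≢a' e = a≢a' (Fin.toℕ-injective e)
    collision : ∀ u v → u ≢ v → residue (value u) ≡ residue (value v) →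
      ∃₂ λ x y → x ℕ.≤ h × y ℕ.≤ h × ∃ λ M → + x * + x + + y * + y + + 1 ≡ M * + p
    collision (inj₁ a) (inj₁ a') u≢v e = ⊥-elim (squares-incongruent pp h refl (toℕ-≢ (u≢v ∘ cong inj₁)) (≤h a) (≤h a')
      (quotient (value (inj₁ a)) (value (inj₁ a'))) (congruent (value (inj₁ a)) (value (inj₁ a')) e))
    collision (inj₂ b) (inj₂ b') u≢v e = ⊥-elim (squares-incongruent pp h refl (toℕ-≢ (u≢v ∘ cong inj₂ ∘ sym)) (≤h b') (≤h b)
      (quotient (value (inj₂ b)) (value (inj₂ b')))
      (trans (swap (square (toℕ b)) (square (toℕ b'))) (congruent (value (inj₂ b)) (value (inj₂ b')) e)))
      where
      swap : ∀ u v → v - u ≡ (-[1+ 0 ] - u) - (-[1+ 0 ] - v)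
      swap = solve-∀
    collision (inj₁ a) (inj₂ b) _ e = toℕ a , toℕ b , ≤h a , ≤h b , quotient (value (inj₁ a)) (value (inj₂ b)) ,
      trans (law (square (toℕ a)) (square (toℕ b))) (congruent (value (inj₁ a)) (value (inj₂ b)) e)
      where
      law : ∀ X Y → X + Y + + 1 ≡ X - (-[1+ 0 ] - Y)
      law = solve-∀
    collision (inj₂ b) (inj₁ a) _ e = toℕ a , toℕ b , ≤h a , ≤h b , - quotient (value (inj₂ b)) (value (inj₁ a)) ,
      law (square (toℕ a)) (square (toℕ b)) (quotient (value (inj₂ b)) (value (inj₁ a))) (+ P)
        (congruent (value (inj₂ b)) (value (inj₁ a)) e)
      where
      law : ∀ X Y c P → (-[1+ 0 ] - Y) - X ≡ c * P → X + Y + + 1 ≡ (- c) * P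
      law X Y c P e = trans (l1 X Y) (trans (cong -_ e) (l2 c P))
        where
        l1 : ∀ X Y → X + Y + + 1 ≡ - ((-[1+ 0 ] - Y) - X)
        l1 = solve-∀
        l2 : ∀ c P → - (c * P) ≡ (- c) * P
        l2 = solve-∀

  four-squares-oddPrime : ∀ {p} → Prime p → ∀ h → 1 ℕ.≤ h → p ≡ suc (h ℕ.+ h) → FourSquares (+ p)
  four-squares-oddPrime {p} pp h 1≤h refl with minus-one-sum-of-two-squares pp h refl
  ... | x , y , x≤h , y≤h , M , xy1≡Mp = start M (trans (sym (as-ℕ x y)) xy1≡Mp) xy1≡Mp
    where
    P = suc (h ℕ.+ h)
    K = x ℕ.* x ℕ.+ y ℕ.* y
    as-ℕ : ∀ x y → + x * + x + + y * + y + + 1 ≡ + suc (x ℕ.* x ℕ.+ y ℕ.* y)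
    as-ℕ x y = trans (cong₂ (λ a b → a + b + + 1) (sym (ℤ.pos-* x x)) (sym (ℤ.pos-* y y)))
               (trans (cong (_+ + 1) (sym (ℤ.pos-+ (x ℕ.* x) (y ℕ.* y))))
               (trans (sym (ℤ.pos-+ (x ℕ.* x ℕ.+ y ℕ.* y) 1)) (cong +_ (ℕ.+-comm _ 1))))
    -- x² + y² + 1 ≤ 2h² + 1 < p², so the multiplier M lies strictly between 0 and p.
    start : (M : ℤ) → + suc K ≡ M * + P → + x * + x + + y * + y + + 1 ≡ M * + P → FourSquares (+ P)
    start (+ zero)   () _
    start -[1+ _ ]   () _
    start (+ suc M') K+1≡MP xy1≡MP = descent pp (suc M') (s≤s z≤n) M<P
        (+ x , + y , + 1 , + 0 , trans (sym xy1≡MP) (law (+ x) (+ y)))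
      where
      law : ∀ X Y → X * X + Y * Y + + 1 ≡ X * X + Y * Y + + 1 * + 1 + + 0 * + 0
      law = solve-∀
      expand : ∀ h → suc (h ℕ.+ h) ℕ.* suc (h ℕ.+ h) ≡ (h ℕ.* h ℕ.+ h ℕ.* h ℕ.+ 1) ℕ.+ (h ℕ.* h ℕ.+ h ℕ.* h ℕ.+ 4 ℕ.* h)
      expand = solve-∀ℕ
      K+1≤ : suc K ℕ.≤ h ℕ.* h ℕ.+ h ℕ.* h ℕ.+ 1
      K+1≤ = ℕ.≤-trans (ℕ.≤-reflexive (ℕ.+-comm 1 K)) (ℕ.+-monoˡ-≤ 1 (ℕ.+-mono-≤ (ℕ.*-mono-≤ x≤h x≤h) (ℕ.*-mono-≤ y≤h y≤h)))
      M<P : suc M' ℕ.< P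
      M<P = ℕ.*-cancelʳ-< P (suc M') P (ℕ.≤-<-trans (ℕ.≤-trans (ℕ.≤-reflexive (sym (ℤ.+-injective (trans K+1≡MP (sym (ℤ.pos-* (suc M') P)))))) K+1≤)
              (ℕ.<-≤-trans (ℕ.m<m+n (h ℕ.* h ℕ.+ h ℕ.* h ℕ.+ 1) (ℕ.<-≤-trans (ℕ.<-≤-trans (s≤s z≤n) (ℕ.*-monoʳ-≤ 4 1≤h)) (ℕ.m≤n+m (4 ℕ.* h) (h ℕ.* h ℕ.+ h ℕ.* h))))
                (ℕ.≤-reflexive (sym (expand h)))))

  four-squares-prime : ∀ p → Prime p → FourSquares (+ p)
  four-squares-prime p pp with parity p
  ... | inj₁ (0 , refl) = ⊥-elim (ℕ.<-irrefl refl (ℕ.>-nonZero⁻¹ 0 {{prime⇒nonZero pp}}))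
  ... | inj₁ (1 , refl) = + 1 , + 1 , + 0 , + 0 , refl
  ... | inj₁ (suc (suc h) , refl) =
    ⊥-elim (prime⇒no-proper-divisor pp 2 (s≤s (s≤s z≤n)) (s≤s (s≤s (ℕ.≤-trans (s≤s z≤n) (ℕ.m≤n+m (suc (suc h)) h))))
      (divides (suc (suc h)) (sym (trans (ℕ.*-comm (suc (suc h)) 2) (cong (suc (suc h) ℕ.+_) (ℕ.+-identityʳ (suc (suc h))))))))
  ... | inj₂ (0 , refl) = ⊥-elim (ℕ.<-irrefl refl (ℕ.nonTrivial⇒n>1 1 {{prime⇒nonTrivial pp}}))
  ... | inj₂ (suc h , p≡) = four-squares-oddPrime pp (suc h) (s≤s z≤n) p≡

  four-squares : ∀ n → FourSquares (+ n)
  four-squares zero    = + 0 , + 0 , + 0 , + 0 , refl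
  four-squares (suc n) = subst FourSquares (cong +_ (sym (PrimeFactorisation.isFactorisation pf)))
    (product-of-primes (PrimeFactorisation.factors pf) (PrimeFactorisation.factorsPrime pf))
    where
    pf = factorise (suc n)
    product-of-primes : ∀ ps → All Prime ps → FourSquares (+ product ps)
    product-of-primes []       []         = + 1 , + 0 , + 0 , + 0 , refl
    product-of-primes (p ∷ ps) (pp ∷ pps) =
      subst FourSquares (sym (ℤ.pos-* p (product ps))) (FourSquares-* (four-squares-prime p pp) (product-of-primes ps pps))

  frame-norm : ∀ a b c d e →
    + 2 * quadForm (a ∷ b ∷ c ∷ d ∷ e ∷ []) (blockGram true) ≡ + 16 * fourSquareSum a b c d + + 24 * (e * e)
  frame-norm a b c d e = law a b c d e
    where
    law : ∀ a b c d e →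
      + 2 * (a * a * + 8 + b * b * + 8 + c * c * + 8 + d * d * + 8 + e * e * + 12 +
        (a * b * + 0 + a * c * + 0 + a * d * + 0 + a * e * + 0 + b * c * + 0 +
         b * d * + 0 + b * e * + 0 + c * d * + 0 + c * e * + 0 + d * e * + 0))
      ≡ + 16 * (a * a + b * b + c * c + d * d) + + 24 * (e * e)
    law = solve-∀


open import Defs
open import Data.Nat as ℕ using (ℕ; zero; suc; _≤_; _*_; s≤s)
open import Data.Nat.Tactic.RingSolver using () renaming (solve-∀ to solve-∀ℕ)
open import Data.Integer as ℤ using (+_)
import Data.Integer.Properties as ℤ
open import Data.Bool using (true)
open import Data.Product using (_×_; _,_; ∃)
open import Data.Sum using (inj₁; inj₂)
open import Data.Vec using ([]; _∷_)
open import Data.Fin using (Fin)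
open import Function.Bundles using (_⇔_; mk⇔)
open import Relation.Binary.PropositionalEquality
open BarnesWallLattice using (fourSquareSum; four-squares; parity; quadForm; blockGram; frame; frame-isFrame; frame-norm; frame⇒even)

frame-of-squares : ∀ m a b c d e (n t : ℕ) → + n ≡ fourSquareSum a b c d → + t ≡ e ℤ.* e →
  16 * n ℕ.+ 24 * t ≡ 4 * m → ∃ λ (f : Fin 32 → V32) → IsFrame m f
frame-of-squares m a b c d e n t n≡ t≡ 16n+24t≡4m = frame x , frame-isFrame m x (begin
  + 2 ℤ.* quadForm x (blockGram true)                             ≡⟨ frame-norm a b c d e ⟩
  + 16 ℤ.* fourSquareSum a b c d ℤ.+ + 24 ℤ.* (e ℤ.* e)          ≡⟨ cong₂ (λ u v → + 16 ℤ.* u ℤ.+ + 24 ℤ.* v) n≡ t≡ ⟨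
  + 16 ℤ.* + n ℤ.+ + 24 ℤ.* + t                                  ≡⟨ cong₂ ℤ._+_ (ℤ.pos-* 16 n) (ℤ.pos-* 24 t) ⟨
  + (16 * n) ℤ.+ + (24 * t)                                      ≡⟨ ℤ.pos-+ (16 * n) (24 * t) ⟨
  + (16 * n ℕ.+ 24 * t)                                          ≡⟨ cong +_ 16n+24t≡4m ⟩
  + (4 * m)                                                      ∎)
  where
  open ≡-Reasoning
  x = a ∷ b ∷ c ∷ d ∷ e ∷ []

-- 2k = 4n + 6e² with e = 0 for even k and e = 1 for odd k ≥ 3, and n is a sum of four squares.
even⇒frame : ∀ m → (∃ λ k → 2 ≤ k × m ≡ 2 * k) → ∃ λ (f : Fin 32 → V32) → IsFrame m f
even⇒frame m (k , 2≤k , refl) with parity k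
... | inj₁ (q , refl) with a , b , c , d , q≡ ← four-squares q =
  frame-of-squares (2 * (q ℕ.+ q)) a b c d (+ 0) q 0 q≡ refl (law q)
  where
  law : ∀ q → 16 * q ℕ.+ 24 * 0 ≡ 4 * (2 * (q ℕ.+ q))
  law = solve-∀ℕ
even⇒frame m (k , s≤s () , refl) | inj₂ (zero , refl)
... | inj₂ (suc q , refl) with a , b , c , d , q≡ ← four-squares q =
  frame-of-squares (2 * suc (suc q ℕ.+ suc q)) a b c d (+ 1) q 1 q≡ refl (law q)
  where
  law : ∀ q → 16 * q ℕ.+ 24 * 1 ≡ 4 * (2 * suc (suc q ℕ.+ suc q))
  law = solve-∀ℕ

proposition5p18 : (m : ℕ) → 1 ≤ m →
    (∃ λ (f : Fin 32 → V32) → IsFrame m f) ⇔ (∃ λ (k : ℕ) → 2 ≤ k × m ≡ 2 * k)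
proposition5p18 m 1≤m = mk⇔ (frame⇒even m 1≤m) (even⇒frame m)
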